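{- Let $D=(V,E)$ be a digraph and $e\in E$. Then \[ \widehat{\sigma\pi}(D)= \begin{cases} \widehat{\sigma\pi}(D_{ -e})+xy\,\widehat{\sigma\pi}(D_{/e}) & \text{if } e \text{ is a loop},\\ \widehat{\sigma\pi}(D_{ -e})+x\,\widehat{\sigma\pi}(D_{/e})+x(z-1)\,\widehat{\sigma\pi}(D_{\dagger e}) & \text{otherwise}. \end{cases} \] Moreover, $\widehat{\sigma\pi}(E_n)=1$ for every $n\ge0$, where $E_n$ is the arcless digraph on $n$ vertices.
   Context: Digraphs are finite directed multigraphs; loops and multiple arcs are allowed. For $F\subseteq E$, $D\langle F\rangle=(V,F)$. $kc(H)$ is the number of components of $H$ that are directed cycles (including loops). $kp(H)$ is the number of components of $H$ that are directed paths with at least one arc. The trivariate cycle-path polynomial is \[ \widehat{\sigma\pi}(D;x,y,z)=\sum_F x^{|F|}y^{kc(D\langle F\rangle)}z^{kp(D\langle F\rangle)}, \] summed over all $F\subseteq E$ in which every vertex has in-degree at most 1 and out-degree at most 1 in $D\langle F\rangle$. The arc operations are as follows. $D_{ -e}$ deletes $e$. If $e=(u,v)$ with $u\ne v$, then $D_{/e}$ removes all arcs with tail $u$ and all arcs with head $v$ (including $e$), and then identifies $u$ and $v$ into one new vertex. If $e=(u,u)$ is a loop, then $D_{/e}$ deletes $u$ and its incident arcs. For $e=(u,v)$, $D_{\dagger e}$ deletes $u$, $v$ and all arcs incident to them. -}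

module Defs where

open import Level using (Level)
open import Data.Bool using (Bool; true; false; not; _∧_; if_then_else_)
open import Data.Nat using (ℕ; zero; suc; _≡ᵇ_; _≤ᵇ_; _≟_)
open import Data.Fin using (Fin)
open import Data.Bool.ListAction using (all; any)
open import Data.Product using (_×_; _,_; proj₁; proj₂)
open import Data.List using (List; []; _∷_; _++_; map; filter; length; concatMap; foldr; removeAt; lookup; upTo; filterᵇ)
open import Data.List.Relation.Unary.All using (All)
open import Data.List.Relation.Unary.Unique.Propositional using (Unique)
open import Data.List.Membership.Propositional using (_∈_)
open import Algebra.Bundles using (CommutativeRing)

-- A finite directed multigraph: vertices are natural-number labels,
-- arcs are a list of (tail , head) pairs (repetitions = parallel arcs,
-- (u , u) = loop).
record Digraph : Set where
  constructor mkDigraph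
  field
    V : List ℕ
    E : List (ℕ × ℕ)
open Digraph public

Arc : Set
Arc = ℕ × ℕ

WF : Digraph → Set
WF D = Unique (V D) × All (λ a → proj₁ a ∈ V D × proj₂ a ∈ V D) (E D)

-- degrees in an arc set F (a loop contributes 1 to both)
indeg : List Arc → ℕ → ℕ
indeg F w = length (filterᵇ (λ a → proj₂ a ≡ᵇ w) F)

outdeg : List Arc → ℕ → ℕ
outdeg F w = length (filterᵇ (λ a → proj₁ a ≡ᵇ w) F)

-- all sub(multi)sets of an arc list, i.e. subsets of arc positions
subsets : {A : Set} → List A → List (List A)
subsets []       = [] ∷ []
subsets (a ∷ as) = subsets as ++ map (a ∷_) (subsets as)

admissible : List ℕ → List Arc → Bool
admissible Vs F = all (λ w → (indeg F w ≤ᵇ 1) ∧ (outdeg F w ≤ᵇ 1)) Vs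

nbrs : List Arc → ℕ → List ℕ
nbrs F w = map proj₂ (filterᵇ (λ a → proj₁ a ≡ᵇ w) F)
        ++ map proj₁ (filterᵇ (λ a → proj₂ a ≡ᵇ w) F)

closure : List Arc → ℕ → List ℕ → List ℕ
closure F zero    S = S
closure F (suc k) S = closure F k (S ++ concatMap (nbrs F) S)

comp : List ℕ → List Arc → ℕ → List ℕ
comp Vs F v = closure F (length Vs) (v ∷ [])

-- v is the least label of its component (one representative per component)
isRep : List ℕ → List Arc → ℕ → Bool
isRep Vs F v = all (λ w → v ≤ᵇ w) (comp Vs F v)

compIsCycle : List ℕ → List Arc → ℕ → Bool
compIsCycle Vs F v = all (λ w → (indeg F w ≡ᵇ 1) ∧ (outdeg F w ≡ᵇ 1)) (comp Vs F v)

compIsPath : List ℕ → List Arc → ℕ → Bool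
compIsPath Vs F v =
  all (λ w → (indeg F w ≤ᵇ 1) ∧ (outdeg F w ≤ᵇ 1)) (comp Vs F v)
  ∧ any (λ w → 1 ≤ᵇ outdeg F w) (comp Vs F v)
  ∧ any (λ w → indeg F w ≡ᵇ 0) (comp Vs F v)

kc : List ℕ → List Arc → ℕ
kc Vs F = length (filterᵇ (λ v → isRep Vs F v ∧ compIsCycle Vs F v) Vs)

kp : List ℕ → List Arc → ℕ
kp Vs F = length (filterᵇ (λ v → isRep Vs F v ∧ compIsPath Vs F v) Vs)

neq : ℕ → ℕ → Bool
neq a b = not (a ≡ᵇ b)

deleteArc : (D : Digraph) → Fin (length (E D)) → Digraph
deleteArc D e = mkDigraph (V D) (removeAt (E D) e)

deleteVertex : ℕ → Digraph → Digraph
deleteVertex u D =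
  mkDigraph (filterᵇ (neq u) (V D))
            (filterᵇ (λ a → neq (proj₁ a) u ∧ neq (proj₂ a) u) (E D))

rename : ℕ → ℕ → ℕ → ℕ
rename v u w = if w ≡ᵇ v then u else w

-- D_{/e}: loop (u,u): delete u.  Non-loop (u,v): remove all arcs with tail u
-- and all arcs with head v, then identify v with u (the merged vertex keeps
-- the label u).
contractArc : (D : Digraph) → Fin (length (E D)) → Digraph
contractArc D e with lookup (E D) e
... | (u , v) =
  if u ≡ᵇ v then deleteVertex u D
  else mkDigraph (filterᵇ (neq v) (V D))
                 (map (λ a → rename v u (proj₁ a) , rename v u (proj₂ a))
                      (filterᵇ (λ a → neq (proj₁ a) u ∧ neq (proj₂ a) v) (E D)))

daggerArc : (D : Digraph) → Fin (length (E D)) → Digraph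
daggerArc D e with lookup (E D) e
... | (u , v) = deleteVertex v (deleteVertex u D)

arcless : ℕ → Digraph
arcless n = mkDigraph (upTo n) []

-- The cycle-path polynomial, evaluated in a commutative ring R at (x,y,z).
-- (A polynomial identity in ℤ[x,y,z] holds iff it holds for every
-- commutative ring and every x, y, z in it.)
module CyclePath {c ℓ : Level} (R : CommutativeRing c ℓ) where
  open CommutativeRing R

  pow : Carrier → ℕ → Carrier
  pow a zero    = 1#
  pow a (suc k) = a * pow a k

  σπ : Digraph → Carrier → Carrier → Carrier → Carrier
  σπ D x y z =
    foldr _+_ 0#
      (map (λ F → pow x (length F) * pow y (kc (V D) F) * pow z (kp (V D) F))
           (filterᵇ (admissible (V D)) (subsets (E D))))

-- Split the admissible arc sets F of D according to whether they contain e.  Those without e are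
-- the admissible arc sets of D₋ₑ.  If F contains a loop e = (u , u), that loop is a cycle component
-- of its own and the rest of F avoids u, so F minus e is an admissible arc set of D/e with one cycle
-- fewer.  If F contains a non-loop e = (u , v), no other arc of F leaves u or enters v, and
-- contracting e maps F minus e onto an admissible arc set of D/e with the same cycles and paths,
-- except when e alone is a path component: then it becomes an isolated vertex and one path is lost.
-- Those exceptional F are e together with an admissible arc set of D†e, which produces the
-- correction x (z - 1) σπ(D†e).
--
-- Components are counted at their least vertex.  Every comparison of component counts rests on two
-- facts: the closure defining a component reaches exactly the vertices connected to it, and the
-- cycle and path tests depend only on the vertex set of a component and the degrees on it.

module Submission where

open import Defs
open import Level using (Level)
open import Data.Nat using (ℕ)
open import Data.Fin using (Fin)
open import Data.List using (length; lookup)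
open import Data.Product using (_×_; _,_; proj₁; proj₂)
open import Relation.Binary.PropositionalEquality using (_≡_; _≢_; refl; sym; cong)
open import Algebra.Bundles using (CommutativeRing)

module Combinatorics where

  open import Data.Bool using (Bool; true; false; not; _∧_; _∨_; if_then_else_; T)
  open import Data.Bool.Properties using (∧-zeroʳ; ∧-identityʳ; ∧-comm; T-∧; T-not-≡)
  open import Data.Bool.ListAction using (all; any)
  open import Data.Empty using (⊥-elim)
  open import Data.Unit using (tt)
  open import Data.Fin using (zero; suc)
  open import Data.Nat using (ℕ; zero; suc; _+_; _≤_; _<_; z≤n; s≤s; _≡ᵇ_; _≤ᵇ_; _≟_)
  open import Data.Nat.Properties
    using (≡ᵇ⇒≡; ≡⇒≡ᵇ; ≤ᵇ⇒≤; ≤⇒≤ᵇ; ≤-refl; ≤-reflexive; ≤-trans; ≤-antisym; <-irrefl; <⇒≱; n≢0⇒n>0;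
           +-suc; +-assoc; +-identityʳ; +-comm; m<m+n; module ≤-Reasoning)
  open import Data.Product using (_×_; _,_; proj₁; proj₂; ∃-syntax)
  open import Data.Sum using (_⊎_; inj₁; inj₂)
  open import Data.List using (List; []; _∷_; _++_; map; filterᵇ; length; concatMap; lookup; removeAt)
  open import Data.List.Properties using (length-filter; filter-some; filter-none; map-++; map-∘; map-id-local)
  open import Data.List.Membership.Propositional using (_∈_; find; lose)
  open import Data.List.Membership.Propositional.Properties
    using (∈-filter⁺; ∈-filter⁻; ∈-++⁺ˡ; ∈-++⁺ʳ; ∈-++⁻; ∈-map⁺; ∈-map⁻; ∈-concatMap⁺; ∈-concatMap⁻)
  open import Data.List.Membership.DecPropositional _≟_ using (_∈?_)
  open import Data.List.Relation.Binary.Subset.Propositional using (_⊆_)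
  open import Data.List.Relation.Unary.Any using (here; there)
  open import Data.List.Relation.Unary.All as All using (All)
  open import Data.List.Relation.Unary.All.Properties using (all⁺; all⁻; all-anti-mono; ¬All⇒Any¬)
  open import Data.List.Relation.Unary.Any.Properties using (any⁺; any⁻)
  open import Data.List.Relation.Unary.Unique.Propositional using (Unique)
  open import Data.List.Relation.Binary.Permutation.Propositional using (_↭_; ↭-refl; ↭-sym; ↭-trans; prep; swap)
  open import Data.List.Relation.Binary.Permutation.Propositional.Properties using (∈-resp-↭; ↭-length; filter-↭)
  open import Data.List.Relation.Unary.AllPairs using (_∷_)
  import Data.List.Relation.Unary.Unique.Propositional.Properties as Unique
  open import Data.List.Extrema.Nat using (min; min≤xs; argmin-all)
  open import Function.Bundles using (Equivalence)
  open import Relation.Binary.Construct.Closure.ReflexiveTransitive as Star using (Star; ε; _◅_; _◅◅_)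
  open import Relation.Binary.PropositionalEquality
    using (_≡_; _≢_; refl; sym; trans; cong; cong₂; subst; subst₂; module ≡-Reasoning)
  open import Function using (_∘′_; case_of_)
  open import Relation.Nullary using (¬_; yes; no)
  open import Relation.Nullary.Decidable using (T?; isYes; toWitness; fromWitness)

  open Equivalence using (to; from)

  T-ext : ∀ {a b} → (T a → T b) → (T b → T a) → a ≡ b
  T-ext {true}  {true}  _ _ = refl
  T-ext {true}  {false} f _ = ⊥-elim (f tt)
  T-ext {false} {true}  _ g = ⊥-elim (g tt)
  T-ext {false} {false} _ _ = refl

  T⇒≡true : ∀ {a} → T a → a ≡ true
  T⇒≡true {true} _ = refl

  ¬T⇒≡false : ∀ {a} → ¬ T a → a ≡ false
  ¬T⇒≡false {true}  n = ⊥-elim (n tt)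
  ¬T⇒≡false {false} _ = refl

  ≡ᵇ-refl : ∀ n → (n ≡ᵇ n) ≡ true
  ≡ᵇ-refl n = T⇒≡true (≡⇒≡ᵇ n n refl)

  ≢⇒≡ᵇ-false : ∀ {m n} → m ≢ n → (m ≡ᵇ n) ≡ false
  ≢⇒≡ᵇ-false {m} {n} m≢n = ¬T⇒≡false (λ t → m≢n (≡ᵇ⇒≡ m n t))

  neq⇒≢ : ∀ {a b} → T (neq a b) → a ≢ b
  neq⇒≢ {a} t refl = subst (λ x → T (not x)) (≡ᵇ-refl a) t

  ≢⇒neq : ∀ {a b} → a ≢ b → T (neq a b)
  ≢⇒neq a≢b = subst (λ x → T (not x)) (sym (≢⇒≡ᵇ-false a≢b)) tt

  𝟙 : Bool → ℕ
  𝟙 b = if b then 1 else 0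

  module _ {A : Set} where

    count : (A → Bool) → List A → ℕ
    count p L = length (filterᵇ p L)

    filterᵇ-cong : ∀ (p q : A → Bool) L → (∀ {x} → x ∈ L → p x ≡ q x) → filterᵇ p L ≡ filterᵇ q L
    filterᵇ-cong p q []      _  = refl
    filterᵇ-cong p q (x ∷ L) eq with p x | q x | eq (here refl)
    ... | true  | true  | refl = cong (x ∷_) (filterᵇ-cong p q L (eq ∘′ there))
    ... | false | false | refl = filterᵇ-cong p q L (eq ∘′ there)

    count-cong : ∀ (p q : A → Bool) L → (∀ {x} → x ∈ L → p x ≡ q x) → count p L ≡ count q L
    count-cong p q L eq = cong length (filterᵇ-cong p q L eq)

    filterᵇ-filterᵇ : ∀ (p q : A → Bool) L → filterᵇ p (filterᵇ q L) ≡ filterᵇ (λ x → p x ∧ q x) L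
    filterᵇ-filterᵇ p q [] = refl
    filterᵇ-filterᵇ p q (x ∷ L) with q x
    ... | false rewrite ∧-zeroʳ (p x) = filterᵇ-filterᵇ p q L
    ... | true rewrite ∧-identityʳ (p x) with p x
    ...   | true  = cong (x ∷_) (filterᵇ-filterᵇ p q L)
    ...   | false = filterᵇ-filterᵇ p q L

    count-split : ∀ (p q : A → Bool) L →
      count p L ≡ count (λ x → p x ∧ q x) L + count (λ x → p x ∧ not (q x)) L
    count-split p q [] = refl
    count-split p q (x ∷ L) with p x | q x
    ... | true  | true  = cong suc (count-split p q L)
    ... | true  | false = trans (cong suc (count-split p q L)) (sym (+-suc _ _))
    ... | false | _     = count-split p q L

    count-zero : ∀ (p : A → Bool) L → (∀ {x} → x ∈ L → ¬ T (p x)) → count p L ≡ 0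
    count-zero p L none = cong length (filter-none (λ x → T? (p x)) (All.tabulate none))

    count-pos : ∀ (p : A → Bool) L {x} → x ∈ L → T (p x) → 0 < count p L
    count-pos p L x∈L px = filter-some (λ x → T? (p x)) (lose x∈L px)

    count-< : ∀ (p q : A → Bool) L → (∀ {x} → x ∈ L → T (p x) → T (q x)) →
      ∀ {y} → y ∈ L → T (q y) → ¬ T (p y) → count p L < count q L
    count-< p q L p⇒q {y} y∈L qy ¬py = begin-strict
      count p L                                            ≡⟨ count-cong _ _ L q∧p≡p ⟨
      count (λ x → q x ∧ p x) L                            <⟨ m<m+n _ (count-pos _ L y∈L q∧¬p) ⟩
      count (λ x → q x ∧ p x) L + count (λ x → q x ∧ not (p x)) L ≡⟨ count-split q p L ⟨
      count q L                                            ∎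
      where
      open ≤-Reasoning
      q∧¬p : T (q y ∧ not (p y))
      q∧¬p = from T-∧ (qy , from T-not-≡ (¬T⇒≡false ¬py))
      q∧p≡p : ∀ {x} → x ∈ L → (q x ∧ p x) ≡ p x
      q∧p≡p {x} x∈L with p x in px
      ... | true  = trans (∧-identityʳ (q x)) (T⇒≡true (p⇒q x∈L (subst T (sym px) tt)))
      ... | false = ∧-zeroʳ (q x)

    count-one : ∀ (p : A → Bool) L {u} → Unique L → u ∈ L → T (p u) →
      (∀ {x} → x ∈ L → T (p x) → x ≡ u) → count p L ≡ 1
    count-one p (x ∷ L) (x∉L ∷ _) (here refl) pu only with p x
    ... | true  = cong suc (count-zero p L (λ y∈L py → All.lookup x∉L y∈L (sym (only (there y∈L) py))))
    ... | false = ⊥-elim pu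
    count-one p (x ∷ L) (x∉L ∷ uniq) (there u∈L) pu only with p x in px
    ... | true  = ⊥-elim (All.lookup x∉L u∈L (only (here refl) (subst T (sym px) tt)))
    ... | false = count-one p L uniq u∈L pu (only ∘′ there)

    count-∧-const : ∀ (p : A → Bool) b L → count (λ x → p x ∧ b) L ≡ (if b then count p L else 0)
    count-∧-const p true  L = count-cong _ _ L (λ {x} _ → ∧-identityʳ (p x))
    count-∧-const p false L = count-zero _ L (λ {x} _ t → subst T (∧-zeroʳ (p x)) t)

    all-cong : ∀ (p q : A → Bool) L M → L ⊆ M → M ⊆ L → (∀ {x} → x ∈ L → p x ≡ q x) → all p L ≡ all q M
    all-cong p q L M L⊆M M⊆L eq = T-ext
      (λ t → all⁻ q (All.tabulate λ x∈M → subst T (eq (M⊆L x∈M)) (All.lookup (all⁺ p L t) (M⊆L x∈M))))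
      (λ t → all⁻ p (All.tabulate λ x∈L → subst T (sym (eq x∈L)) (All.lookup (all⁺ q M t) (L⊆M x∈L))))

    any-cong : ∀ (p q : A → Bool) L M → L ⊆ M → M ⊆ L → (∀ {x} → x ∈ L → p x ≡ q x) → any p L ≡ any q M
    any-cong p q L M L⊆M M⊆L eq = T-ext
      (λ t → let _ , x∈L , px = find (any⁻ p L t) in any⁺ q (lose (L⊆M x∈L) (subst T (eq x∈L) px)))
      (λ t → let _ , x∈M , qx = find (any⁻ q M t) in any⁺ p (lose (M⊆L x∈M) (subst T (sym (eq (M⊆L x∈M))) qx)))

  module _ {A B : Set} where

    count-map : ∀ (p : B → Bool) (f : A → B) L → count p (map f L) ≡ count (λ x → p (f x)) L
    count-map p f [] = refl
    count-map p f (x ∷ L) with p (f x)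
    ... | true  = cong suc (count-map p f L)
    ... | false = count-map p f L

  module _ {A : Set} where

    ↭-lookup : ∀ (L : List A) i → L ↭ lookup L i ∷ removeAt L i
    ↭-lookup (a ∷ L) zero    = ↭-refl
    ↭-lookup (a ∷ L) (suc i) = ↭-trans (prep a (↭-lookup L i)) (swap a (lookup L i) ↭-refl)

    filterᵇ-removeAt : ∀ (p : A → Bool) L i → p (lookup L i) ≡ false → filterᵇ p (removeAt L i) ≡ filterᵇ p L
    filterᵇ-removeAt p (a ∷ L) zero    pa rewrite pa = refl
    filterᵇ-removeAt p (a ∷ L) (suc i) pl with p a
    ... | true  = cong (a ∷_) (filterᵇ-removeAt p L i pl)
    ... | false = filterᵇ-removeAt p L i pl

    removeAt-⊆ : ∀ (L : List A) i → removeAt L i ⊆ L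
    removeAt-⊆ (a ∷ L) zero    b∈          = there b∈
    removeAt-⊆ (a ∷ L) (suc i) (here refl) = here refl
    removeAt-⊆ (a ∷ L) (suc i) (there b∈)  = there (removeAt-⊆ L i b∈)

    subsets-⊆ : ∀ L {G : List A} → G ∈ subsets L → G ⊆ L
    subsets-⊆ [] (here refl) ()
    subsets-⊆ (a ∷ L) G∈ with ∈-++⁻ (subsets L) G∈
    ... | inj₁ G∈L = there ∘′ subsets-⊆ L G∈L
    ... | inj₂ G∈aL with ∈-map⁻ (a ∷_) G∈aL
    ...   | G , G∈L , refl = λ { (here refl) → here refl ; (there b∈) → there (subsets-⊆ L G∈L b∈) }

    all-false : ∀ (p : A → Bool) {G a} → a ∈ G → p a ≡ false → all p G ≡ false
    all-false p {G} a∈ pa = ¬T⇒≡false (λ t → subst T pa (All.lookup (all⁺ p G t) a∈))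

    all-sublist-filterᵇ : ∀ (p : A → Bool) L {G} → G ∈ subsets (filterᵇ p L) → all p G ≡ true
    all-sublist-filterᵇ p L G∈ = T⇒≡true (all⁻ p (All.tabulate λ a∈ →
      proj₂ (∈-filter⁻ (λ a → T? (p a)) {xs = L} (subsets-⊆ _ G∈ a∈))))

  subsets-map : ∀ {A B : Set} (f : A → B) L → subsets (map f L) ≡ map (map f) (subsets L)
  subsets-map f [] = refl
  subsets-map f (a ∷ L) rewrite subsets-map f L = begin
    map (map f) (subsets L) ++ map (f a ∷_) (map (map f) (subsets L))
      ≡⟨ cong (map (map f) (subsets L) ++_) (trans (sym (map-∘ (subsets L))) (map-∘ (subsets L))) ⟩
    map (map f) (subsets L) ++ map (map f) (map (a ∷_) (subsets L))
      ≡⟨ map-++ (map f) (subsets L) _ ⟨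
    map (map f) (subsets L ++ map (a ∷_) (subsets L)) ∎
    where open ≡-Reasoning

  _∈ᵇ_ : ℕ → List ℕ → Bool
  w ∈ᵇ L = isYes (w ∈? L)

  ∈⇒T∈ᵇ : ∀ {w L} → w ∈ L → T (w ∈ᵇ L)
  ∈⇒T∈ᵇ {w} {L} = fromWitness {a? = w ∈? L}

  T∈ᵇ⇒∈ : ∀ {w L} → T (w ∈ᵇ L) → w ∈ L
  T∈ᵇ⇒∈ {w} {L} = toWitness {a? = w ∈? L}

  _∖_ : List ℕ → ℕ → List ℕ
  Vs ∖ u = filterᵇ (neq u) Vs

  ∈-∖⁻ : ∀ {u Vs w} → w ∈ Vs ∖ u → w ∈ Vs × w ≢ u
  ∈-∖⁻ {u} w∈ with ∈-filter⁻ (λ x → T? (neq u x)) w∈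
  ... | w∈Vs , u≢w = w∈Vs , λ w≡u → neq⇒≢ u≢w (sym w≡u)

  ∈-∖⁺ : ∀ {u Vs w} → w ∈ Vs → w ≢ u → w ∈ Vs ∖ u
  ∈-∖⁺ {u} w∈Vs w≢u = ∈-filter⁺ (λ x → T? (neq u x)) w∈Vs (≢⇒neq (λ u≡w → w≢u (sym u≡w)))

  Unique-∖ : ∀ {u Vs} → Unique Vs → Unique (Vs ∖ u)
  Unique-∖ {u} = Unique.filter⁺ (λ x → T? (neq u x))

  ∖-comm : ∀ Vs u v → (Vs ∖ v) ∖ u ≡ (Vs ∖ u) ∖ v
  ∖-comm Vs u v = trans (filterᵇ-filterᵇ (neq u) (neq v) Vs)
    (trans (filterᵇ-cong _ _ Vs (λ {w} _ → ∧-comm (neq u w) (neq v w))) (sym (filterᵇ-filterᵇ (neq v) (neq u) Vs)))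

  count-∖ : ∀ (p : ℕ → Bool) Vs {u} → Unique Vs → u ∈ Vs → count p Vs ≡ count p (Vs ∖ u) + 𝟙 (p u)
  count-∖ p Vs {u} uniq u∈Vs = trans (count-split p (neq u) Vs)
    (cong₂ _+_ (cong length (sym (filterᵇ-filterᵇ p (neq u) Vs))) at-u)
    where
    ≡u : ∀ {x} → T (p x ∧ not (neq u x)) → x ≡ u
    ≡u {x} t with u ≡ᵇ x in u≡x | proj₂ (to (T-∧ {p x}) t)
    ... | true | _ = sym (≡ᵇ⇒≡ u x (subst T (sym u≡x) tt))
    at-u : count (λ x → p x ∧ not (neq u x)) Vs ≡ 𝟙 (p u)
    at-u with p u in pu
    ... | true  = count-one _ Vs uniq u∈Vs (from T-∧ (subst T (sym pu) tt , subst (λ b → T (not (not b))) (sym (≡ᵇ-refl u)) tt))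
                    (λ _ t → ≡u t)
    ... | false = count-zero _ Vs λ {x} _ t → subst T (trans (cong p (≡u t)) pu) (proj₁ (to (T-∧ {p x}) t))

  minimalIn : List ℕ → ℕ → Bool
  minimalIn M w = w ∈ᵇ M ∧ all (w ≤ᵇ_) M

  count-minimalIn : ∀ Vs {M u} → Unique Vs → M ⊆ Vs → u ∈ M → count (minimalIn M) Vs ≡ 1
  count-minimalIn Vs {M} {u} uniq M⊆Vs u∈M =
    count-one _ Vs uniq (M⊆Vs μ∈M) (from T-∧ (∈⇒T∈ᵇ μ∈M , all⁻ _ (All.map ≤⇒≤ᵇ μ≤M))) ≡μ
    where
    μ = min u M
    μ∈M : μ ∈ M
    μ∈M = argmin-all (λ x → x) {P = _∈ M} u∈M (All.tabulate (λ x∈ → x∈))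
    μ≤M : All (μ ≤_) M
    μ≤M = min≤xs u M
    ≡μ : ∀ {x} → x ∈ Vs → T (minimalIn M x) → x ≡ μ
    ≡μ {x} _ t with to (T-∧ {x ∈ᵇ M}) t
    ... | x∈M , x≤M = ≤-antisym (≤ᵇ⇒≤ x μ (All.lookup (all⁺ _ M x≤M) μ∈M)) (All.lookup μ≤M (T∈ᵇ⇒∈ x∈M))

  -- Connectivity and components

  Adj : List Arc → ℕ → ℕ → Set
  Adj F a b = (a , b) ∈ F ⊎ (b , a) ∈ F

  Conn : List Arc → ℕ → ℕ → Set
  Conn F = Star (Adj F)

  Adj-sym : ∀ {F a b} → Adj F a b → Adj F b a
  Adj-sym (inj₁ ab) = inj₂ ab
  Adj-sym (inj₂ ba) = inj₁ ba

  Conn-sym : ∀ {F a b} → Conn F a b → Conn F b a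
  Conn-sym = Star.reverse Adj-sym

  Adj-mono : ∀ {F F'} → F ⊆ F' → ∀ {a b} → Adj F a b → Adj F' a b
  Adj-mono F⊆F' (inj₁ ab) = inj₁ (F⊆F' ab)
  Adj-mono F⊆F' (inj₂ ba) = inj₂ (F⊆F' ba)

  Conn-mono : ∀ {F F'} → F ⊆ F' → ∀ {a b} → Conn F a b → Conn F' a b
  Conn-mono F⊆F' = Star.map (Adj-mono F⊆F')

  EndsIn : List ℕ → List Arc → Set
  EndsIn Vs F = All (λ a → proj₁ a ∈ Vs × proj₂ a ∈ Vs) F

  Adj-∈ : ∀ {Vs F a b} → EndsIn Vs F → Adj F a b → b ∈ Vs
  Adj-∈ ends (inj₁ ab) = proj₂ (All.lookup ends ab)
  Adj-∈ ends (inj₂ ba) = proj₁ (All.lookup ends ba)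

  Conn-∈ : ∀ {Vs F a b} → EndsIn Vs F → a ∈ Vs → Conn F a b → b ∈ Vs
  Conn-∈ ends a∈Vs ε        = a∈Vs
  Conn-∈ ends a∈Vs (ab ◅ c) = Conn-∈ ends (Adj-∈ ends ab) c

  Adj⇒∈nbrs : ∀ {F a b} → Adj F a b → b ∈ nbrs F a
  Adj⇒∈nbrs {F} {a} (inj₁ ab) =
    ∈-++⁺ˡ (∈-map⁺ proj₂ (∈-filter⁺ (λ e → T? (proj₁ e ≡ᵇ a)) ab (≡⇒≡ᵇ a a refl)))
  Adj⇒∈nbrs {F} {a} (inj₂ ba) =
    ∈-++⁺ʳ _ (∈-map⁺ proj₁ (∈-filter⁺ (λ e → T? (proj₂ e ≡ᵇ a)) ba (≡⇒≡ᵇ a a refl)))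

  ∈nbrs⇒Adj : ∀ {F a b} → b ∈ nbrs F a → Adj F a b
  ∈nbrs⇒Adj {F} {a} b∈ with ∈-++⁻ (map proj₂ (filterᵇ (λ e → proj₁ e ≡ᵇ a) F)) b∈
  ... | inj₁ b∈out with ∈-map⁻ proj₂ b∈out
  ...   | (s , _) , e∈ , refl with ∈-filter⁻ (λ e → T? (proj₁ e ≡ᵇ a)) e∈
  ...     | ab , s≡a rewrite ≡ᵇ⇒≡ s a s≡a = inj₁ ab
  ∈nbrs⇒Adj {F} {a} b∈ | inj₂ b∈in with ∈-map⁻ proj₁ b∈in
  ...   | (_ , t) , e∈ , refl with ∈-filter⁻ (λ e → T? (proj₂ e ≡ᵇ a)) e∈
  ...     | ba , t≡a rewrite ≡ᵇ⇒≡ t a t≡a = inj₂ ba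

  grow : List Arc → List ℕ → List ℕ
  grow F S = S ++ concatMap (nbrs F) S

  closure-grow : ∀ F k S → closure F k (grow F S) ≡ grow F (closure F k S)
  closure-grow F zero    S = refl
  closure-grow F (suc k) S = closure-grow F k (grow F S)

  ⊆-closure : ∀ F k S → S ⊆ closure F k S
  ⊆-closure F zero    S x∈S = x∈S
  ⊆-closure F (suc k) S x∈S = ⊆-closure F k (grow F S) (∈-++⁺ˡ x∈S)

  grow-sound : ∀ F S {x} → x ∈ grow F S → ∃[ s ] (s ∈ S × Conn F s x)
  grow-sound F S x∈ with ∈-++⁻ S x∈
  ... | inj₁ x∈S = _ , x∈S , ε
  ... | inj₂ x∈N with find (∈-concatMap⁻ (nbrs F) x∈N)
  ...   | s , s∈S , x∈nbrs = s , s∈S , ∈nbrs⇒Adj x∈nbrs ◅ ε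

  closure-sound : ∀ F k S {x} → x ∈ closure F k S → ∃[ s ] (s ∈ S × Conn F s x)
  closure-sound F zero    S x∈ = _ , x∈ , ε
  closure-sound F (suc k) S x∈ with closure-sound F k (grow F S) x∈
  ... | t , t∈ , t→x with grow-sound F S t∈
  ...   | s , s∈S , s→t = s , s∈S , s→t ◅◅ t→x

  grow-mono : ∀ {F F' S S'} → F ⊆ F' → S ⊆ S' → grow F S ⊆ grow F' S'
  grow-mono {F} {F'} {S} {S'} F⊆F' S⊆S' x∈ with ∈-++⁻ S x∈
  ... | inj₁ x∈S = ∈-++⁺ˡ (S⊆S' x∈S)
  ... | inj₂ x∈N with find (∈-concatMap⁻ (nbrs F) x∈N)
  ...   | s , s∈S , x∈nbrs =
    ∈-++⁺ʳ S' (∈-concatMap⁺ (nbrs F') (lose (S⊆S' s∈S) (Adj⇒∈nbrs (Adj-mono F⊆F' (∈nbrs⇒Adj x∈nbrs)))))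

  closure-mono : ∀ {F F'} k {S S'} → F ⊆ F' → S ⊆ S' → closure F k S ⊆ closure F' k S'
  closure-mono zero    F⊆F' S⊆S' = S⊆S'
  closure-mono (suc k) F⊆F' S⊆S' = closure-mono k F⊆F' (grow-mono F⊆F' S⊆S')

  comp-sound : ∀ Vs F v {x} → x ∈ comp Vs F v → Conn F v x
  comp-sound Vs F v x∈ with closure-sound F (length Vs) (v ∷ []) x∈
  ... | _ , here refl , v→x = v→x

  -- Each round of the closure either is closed under adjacency or gains a vertex of Vs,
  -- so length Vs rounds suffice.
  module _ {Vs F} (ends : EndsIn Vs F) {v} (v∈Vs : v ∈ Vs) where

    private
      C : ℕ → List ℕ
      C k = closure F k (v ∷ [])

      size : ℕ → ℕ
      size k = count (_∈ᵇ C k) Vs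

      Closed : List ℕ → Set
      Closed S = ∀ {x y} → x ∈ S → Adj F x y → y ∈ S

      C-grow : ∀ k → C (suc k) ≡ grow F (C k)
      C-grow k = closure-grow F k (v ∷ [])

      C⊆Vs : ∀ k → C k ⊆ Vs
      C⊆Vs k x∈ with closure-sound F k (v ∷ []) x∈
      ... | _ , here refl , v→x = Conn-∈ ends v∈Vs v→x

      C⊆C-suc : ∀ k → C k ⊆ C (suc k)
      C⊆C-suc k x∈ rewrite C-grow k = ∈-++⁺ˡ x∈

      closed-if-stable : ∀ k → All (_∈ C k) (concatMap (nbrs F) (C k)) → Closed (C (suc k))
      closed-if-stable k stable x∈ xy rewrite C-grow k =
        ∈-++⁺ˡ (back (∈-++⁺ʳ (C k) (∈-concatMap⁺ (nbrs F) (lose (back x∈) (Adj⇒∈nbrs xy)))))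
        where
        back : grow F (C k) ⊆ C k
        back y∈ with ∈-++⁻ (C k) y∈
        ... | inj₁ y∈C = y∈C
        ... | inj₂ y∈N = All.lookup stable y∈N

      grows-or-closed : ∀ k → k < size k ⊎ Closed (C k)
      grows-or-closed zero = inj₁ (count-pos _ Vs v∈Vs (∈⇒T∈ᵇ (here refl)))
      grows-or-closed (suc k) with All.all? (_∈? C k) (concatMap (nbrs F) (C k))
      ... | yes stable = inj₂ (closed-if-stable k stable)
      ... | no unstable with find (¬All⇒Any¬ (_∈? C k) _ unstable) | grows-or-closed k
      ...   | y , y∈N , y∉C | inj₂ closed with find (∈-concatMap⁻ (nbrs F) y∈N)
      ...     | s , s∈C , y∈nbrs = ⊥-elim (y∉C (closed s∈C (∈nbrs⇒Adj y∈nbrs)))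
      grows-or-closed (suc k) | no _ | y , y∈N , y∉C | inj₁ k<size = inj₁ (≤-trans (s≤s k<size)
        (count-< _ _ Vs (λ _ t → ∈⇒T∈ᵇ (C⊆C-suc k (T∈ᵇ⇒∈ t))) (C⊆Vs (suc k) y∈C-suc)
                 (∈⇒T∈ᵇ y∈C-suc) (λ t → y∉C (T∈ᵇ⇒∈ t))))
        where
        y∈C-suc : y ∈ C (suc k)
        y∈C-suc rewrite C-grow k = ∈-++⁺ʳ (C k) y∈N

      comp-closed : Closed (comp Vs F v)
      comp-closed with grows-or-closed (length Vs)
      ... | inj₂ closed = closed
      ... | inj₁ n<size = ⊥-elim (<-irrefl refl (≤-trans n<size (length-filter _ Vs)))

      comp-closed* : ∀ {x y} → x ∈ comp Vs F v → Conn F x y → y ∈ comp Vs F v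
      comp-closed* x∈ ε        = x∈
      comp-closed* x∈ (xz ◅ c) = comp-closed* (comp-closed x∈ xz) c

    comp-complete : ∀ {x} → Conn F v x → x ∈ comp Vs F v
    comp-complete = comp-closed* (⊆-closure F (length Vs) (v ∷ []) (here refl))

  comp-⊆ : ∀ {Vs' F'} → EndsIn Vs' F' → ∀ Vs F {v} → v ∈ Vs' →
    (∀ {b} → Conn F v b → Conn F' v b) → comp Vs F v ⊆ comp Vs' F' v
  comp-⊆ ends' Vs F v∈Vs' conn x∈ = comp-complete ends' v∈Vs' (conn (comp-sound Vs F _ x∈))

  degree : (Arc → ℕ) → List Arc → ℕ → ℕ
  degree end F w = count (λ a → end a ≡ᵇ w) F

  module _ (end : Arc → ℕ) where

    degree-∷-≢ : ∀ {a} F {w} → end a ≢ w → degree end (a ∷ F) w ≡ degree end F w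
    degree-∷-≢ F a≢w rewrite ≢⇒≡ᵇ-false a≢w = refl

    degree-∷-≡ : ∀ {a} F {w} → end a ≡ w → degree end (a ∷ F) w ≡ suc (degree end F w)
    degree-∷-≡ {a} F refl rewrite ≡ᵇ-refl (end a) = refl

    degree-zero : ∀ F {w} → (∀ {a} → a ∈ F → end a ≢ w) → degree end F w ≡ 0
    degree-zero F {w} none = count-zero _ F (λ a∈ t → none a∈ (≡ᵇ⇒≡ _ w t))

    degree-pos : ∀ {F a} → a ∈ F → 0 < degree end F (end a)
    degree-pos {F} {a} a∈ = count-pos _ F a∈ (≡⇒≡ᵇ (end a) (end a) refl)

    degree-witness : ∀ F {w} → 0 < degree end F w → ∃[ a ] (a ∈ F × end a ≡ w)
    degree-witness (a ∷ F) {w} pos with end a ≡ᵇ w in eq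
    ... | true  = a , here refl , ≡ᵇ⇒≡ _ w (subst T (sym eq) tt)
    ... | false = let b , b∈ , eb = degree-witness F pos in b , there b∈ , eb

  SameDegrees : List Arc → List Arc → ℕ → Set
  SameDegrees F F' w = indeg F w ≡ indeg F' w × outdeg F w ≡ outdeg F' w

  admissibleAt : List Arc → ℕ → Bool
  admissibleAt F w = (indeg F w ≤ᵇ 1) ∧ (outdeg F w ≤ᵇ 1)

  T-admissible : ∀ Vs F → T (admissible Vs F) → ∀ {w} → w ∈ Vs → indeg F w ≤ 1 × outdeg F w ≤ 1
  T-admissible Vs F t w∈ with to (T-∧ {indeg F _ ≤ᵇ 1}) (All.lookup (all⁺ (admissibleAt F) Vs t) w∈)
  ... | i , o = ≤ᵇ⇒≤ _ 1 i , ≤ᵇ⇒≤ _ 1 o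

  admissibleAt-intro : ∀ F w → indeg F w ≤ 1 → outdeg F w ≤ 1 → T (admissibleAt F w)
  admissibleAt-intro F w i≤1 o≤1 = from T-∧ (≤⇒≤ᵇ i≤1 , ≤⇒≤ᵇ o≤1)

  admissible-intro : ∀ Vs F → (∀ {w} → w ∈ Vs → indeg F w ≤ 1 × outdeg F w ≤ 1) → T (admissible Vs F)
  admissible-intro Vs F low = all⁻ (admissibleAt F) {Vs}
    (All.tabulate λ {w} w∈ → admissibleAt-intro F w (proj₁ (low w∈)) (proj₂ (low w∈)))

  admissible-[] : ∀ Vs → admissible Vs [] ≡ true
  admissible-[] Vs = T⇒≡true (admissible-intro Vs [] (λ _ → z≤n , z≤n))

  admissible-∖ : ∀ Vs {F G u} → T (admissibleAt F u) → (∀ {w} → w ≢ u → SameDegrees F G w) →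
    admissible Vs F ≡ admissible (Vs ∖ u) G
  admissible-∖ Vs {F} {G} {u} ok-u same = T-ext
    (λ t → all⁻ _ (All.tabulate λ w∈ → let w∈Vs , w≢u = ∈-∖⁻ {u} {Vs} w∈ in
                     subst T (at-≡ w≢u) (All.lookup (all⁺ _ Vs t) w∈Vs)))
    (λ t → all⁻ (admissibleAt F) {Vs} (All.tabulate λ {w} w∈Vs → case w ≟ u of λ where
       (yes refl) → ok-u
       (no w≢u)   → subst T (sym (at-≡ w≢u)) (All.lookup (all⁺ _ (Vs ∖ u) t) (∈-∖⁺ {u} {Vs} w∈Vs w≢u))))
    where
    at-≡ : ∀ {w} → w ≢ u → admissibleAt F w ≡ admissibleAt G w
    at-≡ w≢u = cong₂ (λ i o → (i ≤ᵇ 1) ∧ (o ≤ᵇ 1)) (proj₁ (same w≢u)) (proj₂ (same w≢u))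

  freeᵇ : ℕ → ℕ → Arc → Bool
  freeᵇ u v a = neq (proj₁ a) u ∧ neq (proj₂ a) v

  TailHeadFree : ℕ → ℕ → List Arc → Set
  TailHeadFree u v G = All (λ a → proj₁ a ≢ u × proj₂ a ≢ v) G

  AvoidsVertex : ℕ → List Arc → Set
  AvoidsVertex u = TailHeadFree u u

  T-freeᵇ : ∀ {u v} a → T (freeᵇ u v a) → proj₁ a ≢ u × proj₂ a ≢ v
  T-freeᵇ a t with to (T-∧ {neq (proj₁ a) _}) t
  ... | t≢u , h≢v = neq⇒≢ t≢u , neq⇒≢ h≢v

  freeᵇ-intro : ∀ {u v} a → proj₁ a ≢ u → proj₂ a ≢ v → T (freeᵇ u v a)
  freeᵇ-intro a t≢u h≢v = from T-∧ (≢⇒neq t≢u , ≢⇒neq h≢v)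

  inadmissible-∷ : ∀ Vs {u v G a} → u ∈ Vs → v ∈ Vs → a ∈ G → freeᵇ u v a ≡ false →
    admissible Vs ((u , v) ∷ G) ≡ false
  inadmissible-∷ Vs {u} {v} {G} {a} u∈Vs v∈Vs a∈ not-free = ¬T⇒≡false too-many
    where
    too-many : ¬ T (admissible Vs ((u , v) ∷ G))
    too-many adm with T-admissible Vs ((u , v) ∷ G) adm u∈Vs | T-admissible Vs ((u , v) ∷ G) adm v∈Vs
                    | proj₁ a ≟ u | proj₂ a ≟ v
    ... | _ , out≤1 | _ | yes refl | _ =
      <⇒≱ (s≤s (degree-pos proj₁ a∈)) (subst (_≤ 1) (degree-∷-≡ proj₁ {u , v} G refl) out≤1)
    ... | _ | in≤1 , _ | no _ | yes refl =
      <⇒≱ (s≤s (degree-pos proj₂ a∈)) (subst (_≤ 1) (degree-∷-≡ proj₂ {u , v} G refl) in≤1)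
    ... | _ | _ | no t≢u | no h≢v = subst T not-free (freeᵇ-intro a t≢u h≢v)

  -- Avoiding both u and v implies being free for the arc (u , v).
  filterᵇ-avoids : ∀ u v L → filterᵇ (λ a → freeᵇ v v a ∧ freeᵇ u u a) (filterᵇ (freeᵇ u v) L)
                             ≡ filterᵇ (freeᵇ v v) (filterᵇ (freeᵇ u u) L)
  filterᵇ-avoids u v L = trans (filterᵇ-filterᵇ _ (freeᵇ u v) L)
    (trans (filterᵇ-cong _ _ L λ {a} _ → T-ext (λ t → proj₁ (to (T-∧ {freeᵇ v v a ∧ freeᵇ u u a}) t))
                                             (λ t → from T-∧ (t , free a t)))
           (sym (filterᵇ-filterᵇ (freeᵇ v v) (freeᵇ u u) L)))
    where
    free : ∀ a → T (freeᵇ v v a ∧ freeᵇ u u a) → T (freeᵇ u v a)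
    free a t with to (T-∧ {freeᵇ v v a}) t
    ... | tv , tu = freeᵇ-intro a (proj₁ (T-freeᵇ a tu)) (proj₂ (T-freeᵇ a tv))

  sublist-free : ∀ {u v} L {G} → G ∈ subsets (filterᵇ (freeᵇ u v) L) → TailHeadFree u v G
  sublist-free {u} {v} L G∈ = All.tabulate λ {a} a∈ →
    T-freeᵇ a (proj₂ (∈-filter⁻ (λ b → T? (freeᵇ u v b)) {xs = L} (subsets-⊆ _ G∈ a∈)))

  ∖-ends : ∀ Vs {G u} → EndsIn Vs G → AvoidsVertex u G → EndsIn (Vs ∖ u) G
  ∖-ends Vs ends avoids = All.zipWith
    (λ { ((t∈ , h∈) , (t≢u , h≢u)) → ∈-∖⁺ {Vs = Vs} t∈ t≢u , ∈-∖⁺ {Vs = Vs} h∈ h≢u }) (ends , avoids)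

  avoids⇒isolated : ∀ {G u} → AvoidsVertex u G → ∀ {b} → Conn G u b → b ≡ u
  avoids⇒isolated avoids ε = refl
  avoids⇒isolated avoids (inj₁ ub ◅ _) = ⊥-elim (proj₁ (All.lookup avoids ub) refl)
  avoids⇒isolated avoids (inj₂ bu ◅ _) = ⊥-elim (proj₂ (All.lookup avoids bu) refl)

  contractArc-non-loop : ∀ D i {u v} → lookup (E D) i ≡ (u , v) → u ≢ v →
    contractArc D i ≡ mkDigraph (V D ∖ v) (map (λ a → rename v u (proj₁ a) , rename v u (proj₂ a))
                                               (filterᵇ (freeᵇ u v) (E D)))
  contractArc-non-loop D i eq u≢v with lookup (E D) i
  contractArc-non-loop D i refl u≢v | _ rewrite ≢⇒≡ᵇ-false u≢v = refl

  contractArc-loop : ∀ D i {u} → lookup (E D) i ≡ (u , u) → contractArc D i ≡ deleteVertex u D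
  contractArc-loop D i eq with lookup (E D) i
  contractArc-loop D i refl | (u , _) rewrite ≡ᵇ-refl u = refl

  daggerArc-≡ : ∀ D i {u v} → lookup (E D) i ≡ (u , v) → daggerArc D i ≡ deleteVertex v (deleteVertex u D)
  daggerArc-≡ D i eq with lookup (E D) i
  daggerArc-≡ D i refl | _ = refl

  -- Counting components through their least vertices

  ComponentTest : Set
  ComponentTest = List Arc → List ℕ → Bool

  cycleAt : List Arc → ℕ → Bool
  cycleAt F w = (indeg F w ≡ᵇ 1) ∧ (outdeg F w ≡ᵇ 1)

  T-cycleAt : ∀ F w → T (cycleAt F w) → indeg F w ≡ 1 × outdeg F w ≡ 1
  T-cycleAt F w t with to (T-∧ {indeg F w ≡ᵇ 1}) t
  ... | i , o = ≡ᵇ⇒≡ _ 1 i , ≡ᵇ⇒≡ _ 1 o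

  cycleAt-intro : ∀ F w → indeg F w ≡ 1 → outdeg F w ≡ 1 → T (cycleAt F w)
  cycleAt-intro F w i o rewrite i | o = tt

  isCycleᵇ : ComponentTest
  isCycleᵇ F L = all (cycleAt F) L

  isPathᵇ : ComponentTest
  isPathᵇ F L = all (admissibleAt F) L
    ∧ any (λ w → 1 ≤ᵇ outdeg F w) L
    ∧ any (λ w → indeg F w ≡ᵇ 0) L

  counted : ComponentTest → List ℕ → List Arc → ℕ → Bool
  counted Ψ Vs F v = isRep Vs F v ∧ Ψ F (comp Vs F v)

  components : ComponentTest → List ℕ → List Arc → ℕ
  components Ψ Vs F = count (counted Ψ Vs F) Vs

  DegreeLocal : ComponentTest → Set
  DegreeLocal Ψ = ∀ F F' {L M} → L ⊆ M → M ⊆ L → (∀ {w} → w ∈ L → SameDegrees F F' w) → Ψ F L ≡ Ψ F' M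

  isCycleᵇ-local : DegreeLocal isCycleᵇ
  isCycleᵇ-local F F' L⊆M M⊆L same = all-cong _ _ _ _ L⊆M M⊆L
    (λ w∈ → cong₂ (λ i o → (i ≡ᵇ 1) ∧ (o ≡ᵇ 1)) (proj₁ (same w∈)) (proj₂ (same w∈)))

  isPathᵇ-local : DegreeLocal isPathᵇ
  isPathᵇ-local F F' L⊆M M⊆L same = cong₂ _∧_
    (all-cong _ _ _ _ L⊆M M⊆L (λ w∈ → cong₂ (λ i o → (i ≤ᵇ 1) ∧ (o ≤ᵇ 1)) (proj₁ (same w∈)) (proj₂ (same w∈))))
    (cong₂ _∧_ (any-cong _ _ _ _ L⊆M M⊆L (λ w∈ → cong (1 ≤ᵇ_) (proj₂ (same w∈))))
               (any-cong _ _ _ _ L⊆M M⊆L (λ w∈ → cong (_≡ᵇ 0) (proj₁ (same w∈)))))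

  isCycleᵇ-singleton : ∀ F u → isCycleᵇ F (u ∷ []) ≡ (indeg F u ≡ᵇ 1) ∧ (outdeg F u ≡ᵇ 1)
  isCycleᵇ-singleton F u = ∧-identityʳ _

  isPathᵇ-singleton : ∀ F u → indeg F u ≡ outdeg F u → isPathᵇ F (u ∷ []) ≡ false
  isPathᵇ-singleton F u in≡out =
    trans (cong (λ i → all (admissibleAt F) (u ∷ []) ∧ ((1 ≤ᵇ outdeg F u) ∨ false) ∧ ((i ≡ᵇ 0) ∨ false)) in≡out)
      (flags (all (admissibleAt F) (u ∷ [])) (outdeg F u))
    where
    flags : ∀ a n → a ∧ ((1 ≤ᵇ n) ∨ false) ∧ ((n ≡ᵇ 0) ∨ false) ≡ false
    flags a zero    = ∧-zeroʳ a
    flags a (suc n) = ∧-zeroʳ a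

  isPathᵇ-sources : ∀ F L → T (all (admissibleAt F) L) → T (any (λ w → 1 ≤ᵇ outdeg F w) L) →
    isPathᵇ F L ≡ any (λ w → indeg F w ≡ᵇ 0) L
  isPathᵇ-sources F L low arcs = cong₂ (λ a b → a ∧ b ∧ any (λ w → indeg F w ≡ᵇ 0) L) (T⇒≡true low) (T⇒≡true arcs)

  counted-cong : ∀ {Ψ} → DegreeLocal Ψ → ∀ {Vs F Vs' F' v} →
    comp Vs F v ⊆ comp Vs' F' v → comp Vs' F' v ⊆ comp Vs F v →
    (∀ {w} → w ∈ comp Vs F v → SameDegrees F F' w) → counted Ψ Vs F v ≡ counted Ψ Vs' F' v
  counted-cong local {F = F} {F' = F'} C⊆C' C'⊆C same =
    cong₂ _∧_ (all-cong _ _ _ _ C⊆C' C'⊆C (λ _ → refl)) (local F F' C⊆C' C'⊆C same)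

  counted-isolated : ∀ {Ψ} → DegreeLocal Ψ → ∀ {Vs F u} → EndsIn Vs F → u ∈ Vs →
    (∀ {b} → Conn F u b → b ≡ u) → counted Ψ Vs F u ≡ Ψ F (u ∷ [])
  counted-isolated {Ψ} local {Vs} {F} {u} ends u∈Vs isolated = begin
    isRep Vs F u ∧ Ψ F (comp Vs F u)
      ≡⟨ cong₂ _∧_ (all-cong _ _ _ _ C⊆u u⊆C (λ _ → refl)) (local F F C⊆u u⊆C (λ _ → refl , refl)) ⟩
    all (u ≤ᵇ_) (u ∷ []) ∧ Ψ F (u ∷ [])
      ≡⟨ cong (λ b → (b ∧ true) ∧ Ψ F (u ∷ [])) (T⇒≡true (≤⇒≤ᵇ (≤-refl {u}))) ⟩
    Ψ F (u ∷ []) ∎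
    where
    open ≡-Reasoning
    C⊆u : comp Vs F u ⊆ u ∷ []
    C⊆u x∈ = here (isolated (comp-sound Vs F u x∈))
    u⊆C : u ∷ [] ⊆ comp Vs F u
    u⊆C (here refl) = comp-complete ends u∈Vs ε

  module _ {Ψ} (local : DegreeLocal Ψ) {Vs F} (uniq : Unique Vs) (ends : EndsIn Vs F) where

    counted-class : ∀ {u} → u ∈ Vs → count (λ w → counted Ψ Vs F w ∧ (w ∈ᵇ comp Vs F u)) Vs ≡ 𝟙 (Ψ F (comp Vs F u))
    counted-class {u} u∈Vs = begin
      count (λ w → counted Ψ Vs F w ∧ (w ∈ᵇ Cu)) Vs   ≡⟨ count-cong _ _ Vs pointwise ⟩
      count (λ w → minimalIn Cu w ∧ Ψ F Cu) Vs        ≡⟨ count-∧-const (minimalIn Cu) (Ψ F Cu) Vs ⟩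
      (if Ψ F Cu then count (minimalIn Cu) Vs else 0) ≡⟨ cong (λ n → if Ψ F Cu then n else 0) one ⟩
      𝟙 (Ψ F Cu)                                       ∎
      where
      open ≡-Reasoning
      Cu = comp Vs F u
      one : count (minimalIn Cu) Vs ≡ 1
      one = count-minimalIn Vs uniq (λ x∈ → Conn-∈ ends u∈Vs (comp-sound Vs F u x∈)) (comp-complete ends u∈Vs ε)
      pointwise : ∀ {w} → w ∈ Vs → (counted Ψ Vs F w ∧ (w ∈ᵇ Cu)) ≡ (minimalIn Cu w ∧ Ψ F Cu)
      pointwise {w} w∈Vs with w ∈ᵇ Cu in w∈Cu
      ... | false = ∧-zeroʳ _
      ... | true  = trans (∧-identityʳ _)
            (cong₂ _∧_ (all-cong _ _ _ _ Cw⊆Cu Cu⊆Cw (λ _ → refl)) (local F F Cw⊆Cu Cu⊆Cw (λ _ → refl , refl)))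
        where
        u→w : Conn F u w
        u→w = comp-sound Vs F u (T∈ᵇ⇒∈ (subst T (sym w∈Cu) tt))
        Cw⊆Cu : comp Vs F w ⊆ Cu
        Cw⊆Cu x∈ = comp-complete ends u∈Vs (u→w ◅◅ comp-sound Vs F w x∈)
        Cu⊆Cw : Cu ⊆ comp Vs F w
        Cu⊆Cw x∈ = comp-complete ends w∈Vs (Conn-sym u→w ◅◅ comp-sound Vs F u x∈)

    components-split : ∀ {u} → u ∈ Vs → components Ψ Vs F ≡
      𝟙 (Ψ F (comp Vs F u)) + count (λ w → counted Ψ Vs F w ∧ not (w ∈ᵇ comp Vs F u)) Vs
    components-split {u} u∈Vs = trans (count-split (counted Ψ Vs F) (_∈ᵇ comp Vs F u) Vs)
      (cong (_+ count (λ w → counted Ψ Vs F w ∧ not (w ∈ᵇ comp Vs F u)) Vs) (counted-class u∈Vs))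

    components-∖ : ∀ {G u} → u ∈ Vs → EndsIn (Vs ∖ u) G →
      (∀ {w} → w ≢ u → SameDegrees F G w) →
      (∀ {w b} → w ≢ u → Conn F w b → Conn G w b) → (∀ {w b} → Conn G w b → Conn F w b) →
      components Ψ Vs F ≡ components Ψ (Vs ∖ u) G + 𝟙 (counted Ψ Vs F u)
    components-∖ {G} {u} u∈Vs ends' same F⇒G G⇒F =
      trans (count-∖ (counted Ψ Vs F) Vs uniq u∈Vs) (cong (_+ _) (count-cong _ _ (Vs ∖ u) pointwise))
      where
      pointwise : ∀ {w} → w ∈ Vs ∖ u → counted Ψ Vs F w ≡ counted Ψ (Vs ∖ u) G w
      pointwise {w} w∈ with ∈-∖⁻ {u} {Vs} w∈
      ... | w∈Vs , w≢u = counted-cong local {Vs} {F} {Vs ∖ u} {G} {w}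
        (comp-⊆ ends' Vs F w∈ (F⇒G w≢u)) (comp-⊆ ends (Vs ∖ u) G w∈Vs G⇒F)
        (λ b∈ → same (proj₂ (∈-∖⁻ {u} {Vs} (Conn-∈ ends' w∈ (F⇒G w≢u (comp-sound Vs F w b∈))))))

  kc-[] : ∀ Vs → kc Vs [] ≡ 0
  kc-[] Vs = count-zero _ Vs λ {v} _ t →
    All.lookup (all⁺ (cycleAt []) _ (proj₂ (to (T-∧ {isRep Vs [] v}) t))) (⊆-closure [] (length Vs) (v ∷ []) (here refl))

  kp-[] : ∀ Vs → kp Vs [] ≡ 0
  kp-[] Vs = count-zero _ Vs λ {v} _ t → no-arc (comp Vs [] v) (has-arc {comp Vs [] v} (proj₂ (to (T-∧ {isRep Vs [] v}) t)))
    where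
    has-arc : ∀ {L} → T (isPathᵇ [] L) → T (any (λ w → 1 ≤ᵇ outdeg [] w) L)
    has-arc {L} t = proj₁ (to (T-∧ {any (λ w → 1 ≤ᵇ outdeg [] w) L}) (proj₂ (to (T-∧ {all (admissibleAt []) L}) t)))
    no-arc : ∀ L → ¬ T (any (λ w → 1 ≤ᵇ outdeg [] w) L)
    no-arc L t = proj₂ (proj₂ (find (any⁻ _ L t)))

  module _ {F F' : List Arc} (F↭F' : F ↭ F') where

    private
      F⊆F' : F ⊆ F'
      F⊆F' = ∈-resp-↭ F↭F'

      F'⊆F : F' ⊆ F
      F'⊆F = ∈-resp-↭ (↭-sym F↭F')

    degree-↭ : ∀ end w → degree end F w ≡ degree end F' w
    degree-↭ end w = ↭-length (filter-↭ (λ a → T? (end a ≡ᵇ w)) F↭F')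

    admissible-↭ : ∀ Vs → admissible Vs F ≡ admissible Vs F'
    admissible-↭ Vs = all-cong _ _ Vs Vs (λ w∈ → w∈) (λ w∈ → w∈)
      (λ {w} _ → cong₂ (λ i o → (i ≤ᵇ 1) ∧ (o ≤ᵇ 1)) (degree-↭ proj₂ w) (degree-↭ proj₁ w))

    components-↭ : ∀ {Ψ} → DegreeLocal Ψ → ∀ Vs → components Ψ Vs F ≡ components Ψ Vs F'
    components-↭ local Vs = count-cong _ _ Vs λ {v} _ → counted-cong local {Vs} {F} {Vs} {F'} {v}
      (closure-mono (length Vs) F⊆F' (λ w∈ → w∈)) (closure-mono (length Vs) F'⊆F (λ w∈ → w∈))
      (λ {w} _ → degree-↭ proj₂ w , degree-↭ proj₁ w)

  -- Deleting an isolated vertex, removing a loop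

  module _ {Vs F G u} (uniq : Unique Vs) (u∈Vs : u ∈ Vs) (ends : EndsIn Vs F) (ends' : EndsIn (Vs ∖ u) G)
           (same : ∀ {w} → w ≢ u → SameDegrees F G w)
           (F⇒G : ∀ {w b} → w ≢ u → Conn F w b → Conn G w b) (G⇒F : ∀ {w b} → Conn G w b → Conn F w b)
           (isolated : ∀ {b} → Conn F u b → b ≡ u) where

    components-∖-isolated : ∀ {Ψ} → DegreeLocal Ψ → components Ψ Vs F ≡ components Ψ (Vs ∖ u) G + 𝟙 (Ψ F (u ∷ []))
    components-∖-isolated local = trans (components-∖ local uniq ends u∈Vs ends' same F⇒G G⇒F)
      (cong (λ b → _ + 𝟙 b) (counted-isolated local ends u∈Vs isolated))

  module IsolatedVertex {Vs G u} (uniq : Unique Vs) (u∈Vs : u ∈ Vs) (ends : EndsIn Vs G) (avoids : AvoidsVertex u G) where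

    private
      in-u : indeg G u ≡ 0
      in-u = degree-zero proj₂ G (λ a∈ → proj₂ (All.lookup avoids a∈))

      out-u : outdeg G u ≡ 0
      out-u = degree-zero proj₁ G (λ a∈ → proj₁ (All.lookup avoids a∈))

      components-≡ : ∀ {Ψ} → DegreeLocal Ψ → components Ψ Vs G ≡ components Ψ (Vs ∖ u) G + 𝟙 (Ψ G (u ∷ []))
      components-≡ = components-∖-isolated uniq u∈Vs ends (∖-ends Vs ends avoids)
        (λ _ → refl , refl) (λ _ c → c) (λ c → c) (avoids⇒isolated avoids)

    admissible-≡ : admissible Vs G ≡ admissible (Vs ∖ u) G
    admissible-≡ = admissible-∖ Vs {G} {G}
      (admissibleAt-intro G u (subst (_≤ 1) (sym in-u) z≤n) (subst (_≤ 1) (sym out-u) z≤n)) (λ _ → refl , refl)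

    kc-≡ : kc Vs G ≡ kc (Vs ∖ u) G
    kc-≡ = trans (components-≡ isCycleᵇ-local)
      (trans (cong (λ b → kc (Vs ∖ u) G + 𝟙 b) (trans (isCycleᵇ-singleton G u) (cong (λ i → (i ≡ᵇ 1) ∧ (outdeg G u ≡ᵇ 1)) in-u)))
             (+-identityʳ _))

    kp-≡ : kp Vs G ≡ kp (Vs ∖ u) G
    kp-≡ = trans (components-≡ isPathᵇ-local)
      (trans (cong (λ b → kp (Vs ∖ u) G + 𝟙 b) (isPathᵇ-singleton G u (trans in-u (sym out-u)))) (+-identityʳ _))

  module Loop {Vs G u} (uniq : Unique Vs) (u∈Vs : u ∈ Vs) (ends : EndsIn Vs G) (avoids : AvoidsVertex u G) where

    private
      F = (u , u) ∷ G

      in-u : indeg F u ≡ 1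
      in-u = trans (degree-∷-≡ proj₂ G refl) (cong suc (degree-zero proj₂ G (λ a∈ → proj₂ (All.lookup avoids a∈))))

      out-u : outdeg F u ≡ 1
      out-u = trans (degree-∷-≡ proj₁ G refl) (cong suc (degree-zero proj₁ G (λ a∈ → proj₁ (All.lookup avoids a∈))))

      same : ∀ {w} → w ≢ u → SameDegrees F G w
      same w≢u = degree-∷-≢ proj₂ G (λ u≡w → w≢u (sym u≡w)) , degree-∷-≢ proj₁ G (λ u≡w → w≢u (sym u≡w))

      F⇒G : ∀ {w b} → w ≢ u → Conn F w b → Conn G w b
      F⇒G w≢u ε = ε
      F⇒G w≢u (inj₁ (here refl) ◅ _) = ⊥-elim (w≢u refl)
      F⇒G w≢u (inj₂ (here refl) ◅ _) = ⊥-elim (w≢u refl)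
      F⇒G w≢u (inj₁ (there wb) ◅ c) = inj₁ wb ◅ F⇒G (proj₂ (All.lookup avoids wb)) c
      F⇒G w≢u (inj₂ (there bw) ◅ c) = inj₂ bw ◅ F⇒G (proj₁ (All.lookup avoids bw)) c

      isolated : ∀ {b} → Conn F u b → b ≡ u
      isolated ε = refl
      isolated (inj₁ (here refl) ◅ c) = isolated c
      isolated (inj₂ (here refl) ◅ c) = isolated c
      isolated (inj₁ (there ub) ◅ _) = ⊥-elim (proj₁ (All.lookup avoids ub) refl)
      isolated (inj₂ (there bu) ◅ _) = ⊥-elim (proj₂ (All.lookup avoids bu) refl)

      components-≡ : ∀ {Ψ} → DegreeLocal Ψ → components Ψ Vs F ≡ components Ψ (Vs ∖ u) G + 𝟙 (Ψ F (u ∷ []))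
      components-≡ = components-∖-isolated uniq u∈Vs ((u∈Vs , u∈Vs) All.∷ ends) (∖-ends Vs ends avoids)
        same F⇒G (Conn-mono there) isolated

    admissible-≡ : admissible Vs F ≡ admissible (Vs ∖ u) G
    admissible-≡ = admissible-∖ Vs {F} {G} (admissibleAt-intro F u (≤-reflexive in-u) (≤-reflexive out-u)) same

    kc-≡ : kc Vs F ≡ suc (kc (Vs ∖ u) G)
    kc-≡ = trans (components-≡ isCycleᵇ-local)
      (trans (cong (λ b → kc (Vs ∖ u) G + 𝟙 b)
                   (trans (isCycleᵇ-singleton F u) (cong₂ (λ i o → (i ≡ᵇ 1) ∧ (o ≡ᵇ 1)) in-u out-u)))
             (+-comm _ 1))

    kp-≡ : kp Vs F ≡ kp (Vs ∖ u) G
    kp-≡ = trans (components-≡ isPathᵇ-local)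
      (trans (cong (λ b → kp (Vs ∖ u) G + 𝟙 b) (isPathᵇ-singleton F u (trans in-u (sym out-u)))) (+-identityʳ _))

  -- Contracting a non-loop arc

  module Contraction {Vs G u v} (uniq : Unique Vs) (u∈Vs : u ∈ Vs) (v∈Vs : v ∈ Vs) (u≢v : u ≢ v)
                     (ends : EndsIn Vs G) (free : TailHeadFree u v G) where

    ρ : ℕ → ℕ
    ρ = rename v u

    ρ-arc : Arc → Arc
    ρ-arc a = ρ (proj₁ a) , ρ (proj₂ a)

    F G' : List Arc
    F  = (u , v) ∷ G
    G' = map ρ-arc G

    V' : List ℕ
    V' = Vs ∖ v

    private
      ρ-≢ : ∀ {w} → w ≢ v → ρ w ≡ w
      ρ-≢ w≢v rewrite ≢⇒≡ᵇ-false w≢v = refl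

      ρ-v : ρ v ≡ u
      ρ-v rewrite ≡ᵇ-refl v = refl

      ρ-u : ρ u ≡ u
      ρ-u = ρ-≢ u≢v

      ρ-cases : ∀ w → (w ≡ v × ρ w ≡ u) ⊎ (w ≢ v × ρ w ≡ w)
      ρ-cases w with w ≟ v
      ... | yes refl = inj₁ (refl , ρ-v)
      ... | no w≢v   = inj₂ (w≢v , ρ-≢ w≢v)

      ρ-∈V' : ∀ {w} → w ∈ Vs → ρ w ∈ V'
      ρ-∈V' {w} w∈Vs with ρ-cases w
      ... | inj₁ (refl , ρw≡u) = subst (_∈ V') (sym ρw≡u) (∈-∖⁺ {v} {Vs} u∈Vs u≢v)
      ... | inj₂ (w≢v , ρw≡w) = subst (_∈ V') (sym ρw≡w) (∈-∖⁺ {v} {Vs} w∈Vs w≢v)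

    u∈V' : u ∈ V'
    u∈V' = ∈-∖⁺ {v} {Vs} u∈Vs u≢v

    ends-F : EndsIn Vs F
    ends-F = (u∈Vs , v∈Vs) All.∷ ends

    ends-G' : EndsIn V' G'
    ends-G' = Data.List.Relation.Unary.All.Properties.map⁺
      (All.map (λ { (t∈ , h∈) → ρ-∈V' t∈ , ρ-∈V' h∈ }) ends)

    private
      G-in-v : indeg G v ≡ 0
      G-in-v = degree-zero proj₂ G (λ a∈ → proj₂ (All.lookup free a∈))

      G-out-u : outdeg G u ≡ 0
      G-out-u = degree-zero proj₁ G (λ a∈ → proj₁ (All.lookup free a∈))

      G'-in : ∀ w → indeg G' w ≡ indeg G w
      G'-in w = trans (count-map _ ρ-arc G)
        (count-cong _ _ G (λ a∈ → cong (_≡ᵇ w) (ρ-≢ (proj₂ (All.lookup free a∈)))))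

      G'-out : ∀ {w} → w ≢ u → w ≢ v → outdeg G' w ≡ outdeg G w
      G'-out {w} w≢u w≢v = trans (count-map _ ρ-arc G) (count-cong _ _ G tail)
        where
        tail : ∀ {a} → a ∈ G → (ρ (proj₁ a) ≡ᵇ w) ≡ (proj₁ a ≡ᵇ w)
        tail {a} _ with ρ-cases (proj₁ a)
        ... | inj₁ (refl , ρt≡u) rewrite ρt≡u =
          trans (≢⇒≡ᵇ-false (λ u≡w → w≢u (sym u≡w))) (sym (≢⇒≡ᵇ-false (λ v≡w → w≢v (sym v≡w))))
        ... | inj₂ (_ , ρt≡t) rewrite ρt≡t = refl

      G'-out-u : outdeg G' u ≡ outdeg G v
      G'-out-u = trans (count-map _ ρ-arc G) (count-cong _ _ G tail)
        where
        tail : ∀ {a} → a ∈ G → (ρ (proj₁ a) ≡ᵇ u) ≡ (proj₁ a ≡ᵇ v)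
        tail {a} a∈ with ρ-cases (proj₁ a)
        ... | inj₁ (refl , ρt≡u) rewrite ρt≡u = trans (≡ᵇ-refl u) (sym (≡ᵇ-refl v))
        ... | inj₂ (t≢v , ρt≡t) rewrite ρt≡t =
          trans (≢⇒≡ᵇ-false (proj₁ (All.lookup free a∈))) (sym (≢⇒≡ᵇ-false t≢v))

    in-≡ : ∀ {w} → w ≢ v → indeg F w ≡ indeg G' w
    in-≡ {w} w≢v = trans (degree-∷-≢ proj₂ G (λ v≡w → w≢v (sym v≡w))) (sym (G'-in w))

    out-≡ : ∀ {w} → w ≢ u → w ≢ v → outdeg F w ≡ outdeg G' w
    out-≡ w≢u w≢v = trans (degree-∷-≢ proj₁ G (λ u≡w → w≢u (sym u≡w))) (sym (G'-out w≢u w≢v))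

    out-F-v : outdeg F v ≡ outdeg G' u
    out-F-v = trans (degree-∷-≢ proj₁ G u≢v) (sym G'-out-u)

    in-F-v : indeg F v ≡ 1
    in-F-v = trans (degree-∷-≡ proj₂ G refl) (cong suc G-in-v)

    out-F-u : outdeg F u ≡ 1
    out-F-u = trans (degree-∷-≡ proj₁ G refl) (cong suc G-out-u)

    private
      uv : Adj F u v
      uv = inj₁ (here refl)

      F-ρ : ∀ w → Conn F (ρ w) w
      F-ρ w with ρ-cases w
      ... | inj₁ (refl , ρw≡u) rewrite ρw≡u = uv ◅ ε
      ... | inj₂ (_ , ρw≡w) rewrite ρw≡w = ε

    -- An arc (ρ p , ρ q) of G' comes from the arc (p , q) of G, and ρ w is joined to w by e.
    G'⇒F : ∀ {a b} → Conn G' a b → Conn F a b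
    G'⇒F ε = ε
    G'⇒F (inj₁ x ◅ c) with ∈-map⁻ ρ-arc x
    ... | (p , q) , pq∈ , refl = F-ρ p ◅◅ (inj₁ (there pq∈) ◅ Conn-sym (F-ρ q)) ◅◅ G'⇒F c
    G'⇒F (inj₂ x ◅ c) with ∈-map⁻ ρ-arc x
    ... | (p , q) , pq∈ , refl = F-ρ q ◅◅ (inj₂ (there pq∈) ◅ Conn-sym (F-ρ p)) ◅◅ G'⇒F c

    F⇒G'-ρ : ∀ {a b} → Conn F a b → Conn G' (ρ a) (ρ b)
    F⇒G'-ρ ε = ε
    F⇒G'-ρ {b = b} (inj₁ (here refl) ◅ c) = subst (λ x → Conn G' x (ρ b)) (trans ρ-v (sym ρ-u)) (F⇒G'-ρ c)
    F⇒G'-ρ {b = b} (inj₂ (here refl) ◅ c) = subst (λ x → Conn G' x (ρ b)) (trans ρ-u (sym ρ-v)) (F⇒G'-ρ c)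
    F⇒G'-ρ (inj₁ (there x) ◅ c) = inj₁ (∈-map⁺ ρ-arc x) ◅ F⇒G'-ρ c
    F⇒G'-ρ (inj₂ (there x) ◅ c) = inj₂ (∈-map⁺ ρ-arc x) ◅ F⇒G'-ρ c

    F⇒G' : ∀ {a b} → a ≢ v → b ≢ v → Conn F a b → Conn G' a b
    F⇒G' a≢v b≢v c = subst₂ (Conn G') (ρ-≢ a≢v) (ρ-≢ b≢v) (F⇒G'-ρ c)

    Cu C'u : List ℕ
    Cu  = comp Vs F u
    C'u = comp V' G' u

    private
      ∈Cu : ∀ {b} → Conn F u b → b ∈ Cu
      ∈Cu = comp-complete ends-F u∈Vs

      ∈C'u : ∀ {b} → Conn G' u b → b ∈ C'u
      ∈C'u = comp-complete ends-G' u∈V'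

    v∈Cu : v ∈ Cu
    v∈Cu = ∈Cu (uv ◅ ε)

    C'u⇒Cu : ∀ {b} → b ∈ C'u → b ∈ Cu × b ≢ v
    C'u⇒Cu b∈ = ∈Cu (G'⇒F (comp-sound V' G' u b∈))
              , proj₂ (∈-∖⁻ {v} {Vs} (Conn-∈ ends-G' u∈V' (comp-sound V' G' u b∈)))

    Cu⇒C'u : ∀ {b} → b ∈ Cu → b ≢ v → b ∈ C'u
    Cu⇒C'u b∈ b≢v = ∈C'u (F⇒G' u≢v b≢v (comp-sound Vs F u b∈))

    admissible-≡ : admissible Vs F ≡ admissible V' G'
    admissible-≡ = T-ext (λ t → admissible-intro V' G' (forth (T-admissible Vs F t)))
                         (λ t → admissible-intro Vs F (back (T-admissible V' G' t)))
      where
      Low : List ℕ → List Arc → Set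
      Low Vs F = ∀ {w} → w ∈ Vs → indeg F w ≤ 1 × outdeg F w ≤ 1
      forth : Low Vs F → Low V' G'
      forth low {w} w∈ with ∈-∖⁻ {v} {Vs} w∈
      ... | w∈Vs , w≢v with w ≟ u
      ...   | yes refl = subst (_≤ 1) (in-≡ w≢v) (proj₁ (low w∈Vs)) , subst (_≤ 1) out-F-v (proj₂ (low v∈Vs))
      ...   | no w≢u   = subst (_≤ 1) (in-≡ w≢v) (proj₁ (low w∈Vs))
                       , subst (_≤ 1) (out-≡ w≢u w≢v) (proj₂ (low w∈Vs))
      back : Low V' G' → Low Vs F
      back low {w} w∈Vs with w ≟ v
      ... | yes refl = ≤-reflexive in-F-v , subst (_≤ 1) (sym out-F-v) (proj₂ (low u∈V'))
      ... | no w≢v with w ≟ u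
      ...   | yes refl = subst (_≤ 1) (sym (in-≡ w≢v)) (proj₁ (low u∈V')) , ≤-reflexive out-F-u
      ...   | no w≢u   = subst (_≤ 1) (sym (in-≡ w≢v)) (proj₁ (low w∈V'))
                       , subst (_≤ 1) (sym (out-≡ w≢u w≢v)) (proj₂ (low w∈V'))
        where w∈V' = ∈-∖⁺ {v} {Vs} w∈Vs w≢v

    isCycleᵇ-class : isCycleᵇ F Cu ≡ isCycleᵇ G' C'u
    isCycleᵇ-class = T-ext (λ t → all⁻ (cycleAt G') (All.tabulate (forth (All.lookup (all⁺ (cycleAt F) Cu t)))))
                           (λ t → all⁻ (cycleAt F) (All.tabulate (back (All.lookup (all⁺ (cycleAt G') C'u t)))))
      where
      forth : (∀ {b} → b ∈ Cu → T (cycleAt F b)) → ∀ {b} → b ∈ C'u → T (cycleAt G' b)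
      forth cyc {b} b∈ with C'u⇒Cu b∈
      ... | b∈Cu , b≢v with b ≟ u
      ...   | yes refl = cycleAt-intro G' u (trans (sym (in-≡ b≢v)) (proj₁ (T-cycleAt F b (cyc b∈Cu))))
                                       (trans (sym out-F-v) (proj₂ (T-cycleAt F v (cyc v∈Cu))))
      ...   | no b≢u   = cycleAt-intro G' b (trans (sym (in-≡ b≢v)) (proj₁ (T-cycleAt F b (cyc b∈Cu))))
                                       (trans (sym (out-≡ b≢u b≢v)) (proj₂ (T-cycleAt F b (cyc b∈Cu))))
      back : (∀ {b} → b ∈ C'u → T (cycleAt G' b)) → ∀ {b} → b ∈ Cu → T (cycleAt F b)
      back cyc {b} b∈ with b ≟ v
      ... | yes refl = cycleAt-intro F v in-F-v (trans out-F-v (proj₂ (T-cycleAt G' u (cyc (∈C'u ε)))))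
      ... | no b≢v with b ≟ u
      ...   | yes refl = cycleAt-intro F u (trans (in-≡ b≢v) (proj₁ (T-cycleAt G' u (cyc (∈C'u ε))))) out-F-u
      ...   | no b≢u   = cycleAt-intro F b (trans (in-≡ b≢v) (proj₁ (T-cycleAt G' b (cyc b∈C'u))))
                                       (trans (out-≡ b≢u b≢v) (proj₂ (T-cycleAt G' b (cyc b∈C'u))))
        where b∈C'u = Cu⇒C'u b∈ b≢v

    private
      ∈ᵇ-class : ∀ {w} → w ≢ v → (w ∈ᵇ Cu) ≡ (w ∈ᵇ C'u)
      ∈ᵇ-class w≢v = T-ext (λ t → ∈⇒T∈ᵇ (Cu⇒C'u (T∈ᵇ⇒∈ t) w≢v))
                           (λ t → ∈⇒T∈ᵇ (proj₁ (C'u⇒Cu (T∈ᵇ⇒∈ t))))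

    outside-≡ : ∀ {Ψ} → DegreeLocal Ψ →
      count (λ w → counted Ψ Vs F w ∧ not (w ∈ᵇ Cu)) Vs ≡ count (λ w → counted Ψ V' G' w ∧ not (w ∈ᵇ C'u)) V'
    outside-≡ {Ψ} local = trans (count-cong _ _ Vs pointwise) (cong length (sym (filterᵇ-filterᵇ _ (neq v) Vs)))
      where
      pointwise : ∀ {w} → w ∈ Vs →
        (counted Ψ Vs F w ∧ not (w ∈ᵇ Cu)) ≡ ((counted Ψ V' G' w ∧ not (w ∈ᵇ C'u)) ∧ neq v w)
      pointwise {w} w∈Vs with w ≟ v
      ... | yes refl rewrite T⇒≡true (∈⇒T∈ᵇ v∈Cu) | ≡ᵇ-refl v = trans (∧-zeroʳ _) (sym (∧-zeroʳ _))
      ... | no w≢v rewrite ≢⇒≡ᵇ-false (λ v≡w → w≢v (sym v≡w))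
                         | ∧-identityʳ (counted Ψ V' G' w ∧ not (w ∈ᵇ C'u))
                         | sym (∈ᵇ-class w≢v) with w ∈ᵇ Cu in w∈Cu
      ...   | true  = trans (∧-zeroʳ _) (sym (∧-zeroʳ _))
      ...   | false = cong (_∧ true) (counted-cong local {Vs} {F} {V'} {G'} {w}
                        (comp-⊆ ends-G' Vs F w∈V' F⇒G'-here) (comp-⊆ ends-F V' G' w∈Vs G'⇒F) same)
        where
        w∈V' = ∈-∖⁺ {v} {Vs} w∈Vs w≢v
        u↛w : ¬ Conn F u w
        u↛w c = subst T w∈Cu (∈⇒T∈ᵇ (comp-complete ends-F u∈Vs c))
        F⇒G'-here : ∀ {b} → Conn F w b → Conn G' w b
        F⇒G'-here {b} c with b ≟ v
        ... | yes refl = ⊥-elim (u↛w ((uv ◅ ε) ◅◅ Conn-sym c))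
        ... | no b≢v   = F⇒G' w≢v b≢v c
        same : ∀ {b} → b ∈ comp Vs F w → SameDegrees F G' b
        same {b} b∈ with comp-sound Vs F w b∈ | b ≟ v | b ≟ u
        ... | c | yes refl | _        = ⊥-elim (u↛w ((uv ◅ ε) ◅◅ Conn-sym c))
        ... | c | no _     | yes refl = ⊥-elim (u↛w (Conn-sym c))
        ... | _ | no b≢v   | no b≢u   = in-≡ b≢v , out-≡ b≢u b≢v

    kc-≡ : kc Vs F ≡ kc V' G'
    kc-≡ = begin
      kc Vs F
        ≡⟨ components-split isCycleᵇ-local uniq ends-F u∈Vs ⟩
      𝟙 (isCycleᵇ F Cu) + count (λ w → counted isCycleᵇ Vs F w ∧ not (w ∈ᵇ Cu)) Vs
        ≡⟨ cong₂ (λ b n → 𝟙 b + n) isCycleᵇ-class (outside-≡ isCycleᵇ-local) ⟩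
      𝟙 (isCycleᵇ G' C'u) + count (λ w → counted isCycleᵇ V' G' w ∧ not (w ∈ᵇ C'u)) V'
        ≡⟨ components-split isCycleᵇ-local (Unique-∖ {v} uniq) ends-G' u∈V' ⟨
      kc V' G'
        ∎
      where open ≡-Reasoning

    -- e forms a component of F on its own: no arc of G enters u or leaves v.
    isolatedArc : Bool
    isolatedArc = (indeg G u ≡ᵇ 0) ∧ (outdeg G v ≡ᵇ 0)

    private
      ρ-≡u : ∀ {w} → ρ w ≡ u → w ≡ u ⊎ w ≡ v
      ρ-≡u {w} ρw≡u with ρ-cases w
      ... | inj₁ (w≡v , _)   = inj₂ w≡v
      ... | inj₂ (_ , ρw≡w) = inj₁ (trans (sym ρw≡w) ρw≡u)

      u∈C'u : u ∈ C'u
      u∈C'u = ∈C'u ε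

      Cu⊆Vs : Cu ⊆ Vs
      Cu⊆Vs b∈ = Conn-∈ ends-F u∈Vs (comp-sound Vs F u b∈)

      C'u⊆V' : C'u ⊆ V'
      C'u⊆V' b∈ = Conn-∈ ends-G' u∈V' (comp-sound V' G' u b∈)

      isPathᵇ-F : T (admissible Vs F) → isPathᵇ F Cu ≡ any (λ w → indeg F w ≡ᵇ 0) Cu
      isPathᵇ-F adm = isPathᵇ-sources F Cu (all-anti-mono (admissibleAt F) Cu⊆Vs adm)
        (any⁺ _ (lose (∈Cu ε) (≤⇒≤ᵇ (≤-reflexive (sym out-F-u)))))

      sources-≡ : any (λ w → indeg F w ≡ᵇ 0) Cu ≡ any (λ w → indeg G' w ≡ᵇ 0) C'u
      sources-≡ = T-ext (λ t → forth (find (any⁻ _ Cu t))) (λ t → back (find (any⁻ _ C'u t)))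
        where
        forth : ∃[ b ] (b ∈ Cu × T (indeg F b ≡ᵇ 0)) → T (any (λ w → indeg G' w ≡ᵇ 0) C'u)
        forth (b , b∈ , src) with b ≟ v
        ... | yes refl = ⊥-elim (subst T (cong (_≡ᵇ 0) in-F-v) src)
        ... | no b≢v   = any⁺ _ (lose (Cu⇒C'u b∈ b≢v) (subst T (cong (_≡ᵇ 0) (in-≡ b≢v)) src))
        back : ∃[ b ] (b ∈ C'u × T (indeg G' b ≡ᵇ 0)) → T (any (λ w → indeg F w ≡ᵇ 0) Cu)
        back (b , b∈ , src) with C'u⇒Cu b∈
        ... | b∈Cu , b≢v = any⁺ _ (lose b∈Cu (subst T (cong (_≡ᵇ 0) (sym (in-≡ b≢v))) src))

    isolatedArc-degrees : T isolatedArc → indeg G u ≡ 0 × outdeg G v ≡ 0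
    isolatedArc-degrees bare with to (T-∧ {indeg G u ≡ᵇ 0}) bare
    ... | in0 , out0 = ≡ᵇ⇒≡ _ 0 in0 , ≡ᵇ⇒≡ _ 0 out0

    isPathᵇ-isolatedArc : T (admissible Vs F) → T isolatedArc → isPathᵇ F Cu ≡ true × isPathᵇ G' C'u ≡ false
    isPathᵇ-isolatedArc adm bare =
        trans (isPathᵇ-F adm) (T⇒≡true (any⁺ _ (lose (∈Cu ε) (≡⇒≡ᵇ _ 0 (trans (in-≡ u≢v) (trans (G'-in u) G-in-u))))))
      , trans (isPathᵇ-local G' G' C'u⊆u u⊆C'u (λ _ → refl , refl))
              (isPathᵇ-singleton G' u (trans (G'-in u) (trans G-in-u (trans (sym G-out-v) (sym G'-out-u)))))
      where
      G-in-u = proj₁ (isolatedArc-degrees bare)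
      G-out-v = proj₂ (isolatedArc-degrees bare)
      no-arc : ∀ {y} → ¬ Adj G' u y
      no-arc (inj₁ x) with ∈-map⁻ ρ-arc x
      ... | (p , q) , pq∈ , eq with ρ-≡u {p} (sym (cong proj₁ eq))
      ...   | inj₁ refl = proj₁ (All.lookup free pq∈) refl
      ...   | inj₂ refl = <⇒≱ (degree-pos proj₁ pq∈) (≤-reflexive G-out-v)
      no-arc (inj₂ x) with ∈-map⁻ ρ-arc x
      ... | (p , q) , pq∈ , eq with ρ-≡u {q} (sym (cong proj₂ eq))
      ...   | inj₁ refl = <⇒≱ (degree-pos proj₂ pq∈) (≤-reflexive G-in-u)
      ...   | inj₂ refl = proj₂ (All.lookup free pq∈) refl
      C'u⊆u : C'u ⊆ u ∷ []
      C'u⊆u b∈ with comp-sound V' G' u b∈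
      ... | ε = here refl
      ... | ub ◅ _ = ⊥-elim (no-arc ub)
      u⊆C'u : u ∷ [] ⊆ C'u
      u⊆C'u (here refl) = u∈C'u

    isPathᵇ-≡ : T (admissible Vs F) → ¬ T isolatedArc → isPathᵇ F Cu ≡ isPathᵇ G' C'u
    isPathᵇ-≡ adm not-bare = trans (isPathᵇ-F adm) (trans sources-≡ (sym (isPathᵇ-sources G' C'u
      (all-anti-mono (admissibleAt G') C'u⊆V' (subst T admissible-≡ adm)) arcs)))
      where
      -- Some arc of G enters u or leaves v; after contraction it touches u.
      arcs : T (any (λ w → 1 ≤ᵇ outdeg G' w) C'u)
      arcs with indeg G u ≡ᵇ 0 in in0 | outdeg G v ≡ᵇ 0 in out0
      ... | true  | true  = ⊥-elim (not-bare tt)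
      ... | true  | false = any⁺ _ (lose u∈C'u (≤⇒≤ᵇ (subst (1 ≤_) (sym G'-out-u)
                              (n≢0⇒n>0 (λ z → subst T out0 (≡⇒≡ᵇ _ 0 z))))))
      ... | false | _ with degree-witness proj₂ G (n≢0⇒n>0 (λ z → subst T in0 (≡⇒≡ᵇ _ 0 z)))
      ...   | (p , q) , pq∈ , refl = any⁺ _ (lose (∈C'u (inj₂ pu∈ ◅ ε)) (≤⇒≤ᵇ (degree-pos proj₁ pu∈)))
        where
        pu∈ : (ρ p , u) ∈ G'
        pu∈ = subst (λ z → (ρ p , z) ∈ G') ρ-u (∈-map⁺ ρ-arc pq∈)

    kp-≡ : T (admissible Vs F) → kp Vs F ≡ 𝟙 isolatedArc + kp V' G'
    kp-≡ adm = begin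
      kp Vs F                                                   ≡⟨ components-split isPathᵇ-local uniq ends-F u∈Vs ⟩
      𝟙 (isPathᵇ F Cu) + rest                                    ≡⟨ cong (_+ rest) class ⟩
      (𝟙 isolatedArc + 𝟙 (isPathᵇ G' C'u)) + rest               ≡⟨ +-assoc (𝟙 isolatedArc) _ rest ⟩
      𝟙 isolatedArc + (𝟙 (isPathᵇ G' C'u) + rest)
        ≡⟨ cong (λ n → 𝟙 isolatedArc + (𝟙 (isPathᵇ G' C'u) + n)) (outside-≡ isPathᵇ-local) ⟩
      𝟙 isolatedArc + (𝟙 (isPathᵇ G' C'u) + count (λ w → counted isPathᵇ V' G' w ∧ not (w ∈ᵇ C'u)) V')
        ≡⟨ cong (𝟙 isolatedArc +_) (components-split isPathᵇ-local (Unique-∖ {v} uniq) ends-G' u∈V') ⟨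
      𝟙 isolatedArc + kp V' G'                                  ∎
      where
      open ≡-Reasoning
      rest = count (λ w → counted isPathᵇ Vs F w ∧ not (w ∈ᵇ Cu)) Vs
      class : 𝟙 (isPathᵇ F Cu) ≡ 𝟙 isolatedArc + 𝟙 (isPathᵇ G' C'u)
      class with isolatedArc in bare
      ... | true  rewrite proj₁ (isPathᵇ-isolatedArc adm (subst T (sym bare) tt))
                        | proj₂ (isPathᵇ-isolatedArc adm (subst T (sym bare) tt)) = refl
      ... | false = cong 𝟙 (isPathᵇ-≡ adm (subst T bare))

    isolatedArc-avoids : T isolatedArc → AvoidsVertex u G × AvoidsVertex v G
    isolatedArc-avoids bare = All.tabulate (λ a∈ → proj₁ (All.lookup free a∈) , head≢u a∈)
                            , All.tabulate (λ a∈ → tail≢v a∈ , proj₂ (All.lookup free a∈))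
      where
      head≢u : ∀ {a} → a ∈ G → proj₂ a ≢ u
      head≢u a∈ refl = <⇒≱ (degree-pos proj₂ a∈) (≤-reflexive (proj₁ (isolatedArc-degrees bare)))
      tail≢v : ∀ {a} → a ∈ G → proj₁ a ≢ v
      tail≢v a∈ refl = <⇒≱ (degree-pos proj₁ a∈) (≤-reflexive (proj₂ (isolatedArc-degrees bare)))

    isolatedArc-≡ : isolatedArc ≡ all (λ a → freeᵇ v v a ∧ freeᵇ u u a) G
    isolatedArc-≡ = T-ext
      (λ bare → let avoids-u , avoids-v = isolatedArc-avoids bare in
        all⁻ _ (All.zipWith (λ { ((t≢u , h≢u) , (t≢v , h≢v)) →
                  from T-∧ (freeᵇ-intro _ t≢v h≢v , freeᵇ-intro _ t≢u h≢u) }) (avoids-u , avoids-v)))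
      (λ t → let both = All.map (λ {a} t → to (T-∧ {freeᵇ v v a}) t) (all⁺ _ G t) in
        from T-∧ ( ≡⇒≡ᵇ _ 0 (degree-zero proj₂ G λ {a} a∈ → proj₂ (T-freeᵇ {u} {u} a (proj₂ (All.lookup both a∈))))
                 , ≡⇒≡ᵇ _ 0 (degree-zero proj₁ G λ {a} a∈ → proj₁ (T-freeᵇ {v} {v} a (proj₁ (All.lookup both a∈))))))

    G'≡G : AvoidsVertex v G → G' ≡ G
    G'≡G avoids-v = map-id-local (All.map (λ { (t≢v , h≢v) → cong₂ _,_ (ρ-≢ t≢v) (ρ-≢ h≢v) }) avoids-v)

-- The cycle-path polynomial in a commutative ring

module Expansion {c ℓ} (R : CommutativeRing c ℓ) where

  open import Data.Bool using (Bool; true; false; _∧_; if_then_else_; T)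
  open import Data.Nat using (suc)
  import Data.Nat as ℕ
  open import Data.Product using (_,_; proj₁; proj₂)
  open import Data.Unit using (tt)
  open import Data.Bool.ListAction using (all)
  open import Data.Fin using (Fin)
  open import Data.List using (List; []; _∷_; _++_; map; filterᵇ; foldr; length; lookup; removeAt; upTo)
  open import Data.List.Membership.Propositional.Properties using (∈-filter⁻; ∈-lookup)
  import Data.List.Relation.Unary.All as All
  open import Relation.Nullary.Decidable using (T?)
  open import Data.List.Properties using (length-map)
  open import Data.List.Relation.Binary.Permutation.Propositional.Properties using (↭-length)
  open import Data.List.Relation.Unary.Unique.Propositional using (Unique)
  open import Data.List.Membership.Propositional using (_∈_)
  open import Data.List.Relation.Unary.Any using (here; there)
  open import Data.List.Relation.Binary.Permutation.Propositional as ↭ using (_↭_; prep; swap)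
  open import Function using (_∘′_)
  open import Relation.Binary.PropositionalEquality using (_≡_; _≢_; refl; sym; trans; cong; subst)
  open Combinatorics

  open CommutativeRing R renaming (refl to ≈-refl; sym to ≈-sym; trans to ≈-trans)
  open CyclePath R
  open import Relation.Binary.Reasoning.Setoid setoid
  open import Algebra.Properties.CommutativeSemigroup +-commutativeSemigroup using (interchange)
  open import Algebra.Solver.Ring.NaturalCoefficients.Default commutativeSemiring using (solve; _:*_; _:=_)

  ∑ : {A : Set} → List A → (A → Carrier) → Carrier
  ∑ L f = foldr _+_ 0# (map f L)

  ∑-map : ∀ {A B : Set} (h : A → B) L f → ∑ (map h L) f ≡ ∑ L (λ a → f (h a))
  ∑-map h []      f = refl
  ∑-map h (a ∷ L) f = cong (f (h a) +_) (∑-map h L f)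

  module _ {A : Set} where

    ∑-filterᵇ : ∀ (p : A → Bool) L f → ∑ (filterᵇ p L) f ≈ ∑ L (λ a → if p a then f a else 0#)
    ∑-filterᵇ p []      f = ≈-refl
    ∑-filterᵇ p (a ∷ L) f with p a
    ... | true  = +-congˡ (∑-filterᵇ p L f)
    ... | false = ≈-trans (∑-filterᵇ p L f) (≈-sym (+-identityˡ _))

    ∑-++ : ∀ (L M : List A) f → ∑ (L ++ M) f ≈ ∑ L f + ∑ M f
    ∑-++ []      M f = ≈-sym (+-identityˡ _)
    ∑-++ (a ∷ L) M f = ≈-trans (+-congˡ (∑-++ L M f)) (≈-sym (+-assoc _ _ _))

    ∑-cong : ∀ (L : List A) {f g} → (∀ {a} → a ∈ L → f a ≈ g a) → ∑ L f ≈ ∑ L g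
    ∑-cong []      _  = ≈-refl
    ∑-cong (a ∷ L) eq = +-cong (eq (here refl)) (∑-cong L (eq ∘′ there))

    ∑-+ : ∀ (L : List A) f g → ∑ L (λ a → f a + g a) ≈ ∑ L f + ∑ L g
    ∑-+ []      f g = ≈-sym (+-identityˡ _)
    ∑-+ (a ∷ L) f g = ≈-trans (+-congˡ (∑-+ L f g)) (interchange _ _ _ _)

    ∑-*ˡ : ∀ (L : List A) k f → ∑ L (λ a → k * f a) ≈ k * ∑ L f
    ∑-*ˡ []      k f = ≈-sym (zeroʳ k)
    ∑-*ˡ (a ∷ L) k f = ≈-trans (+-congˡ (∑-*ˡ L k f)) (≈-sym (distribˡ k _ _))

    ∑-zero : ∀ (L : List A) {f} → (∀ {a} → a ∈ L → f a ≈ 0#) → ∑ L f ≈ 0#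
    ∑-zero []      _    = ≈-refl
    ∑-zero (a ∷ L) vanish = ≈-trans (+-cong (vanish (here refl)) (∑-zero L (vanish ∘′ there))) (+-identityˡ 0#)

  module _ {A : Set} where

    ∑-subsets-∷ : ∀ (a : A) L (f : List A → Carrier) →
      ∑ (subsets (a ∷ L)) f ≈ ∑ (subsets L) f + ∑ (subsets L) (λ G → f (a ∷ G))
    ∑-subsets-∷ a L f = ≈-trans (∑-++ (subsets L) _ f) (+-congˡ (reflexive (∑-map (a ∷_) (subsets L) f)))

    ↭-Invariant : (List A → Carrier) → Set _
    ↭-Invariant f = ∀ {G G'} → G ↭ G' → f G ≈ f G'

    ∑-subsets-↭ : ∀ {L L'} → L ↭ L' → ∀ f → ↭-Invariant f → ∑ (subsets L) f ≈ ∑ (subsets L') f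
    ∑-subsets-↭ ↭.refl f inv = ≈-refl
    ∑-subsets-↭ (↭.trans p q) f inv = ≈-trans (∑-subsets-↭ p f inv) (∑-subsets-↭ q f inv)
    ∑-subsets-↭ {a ∷ L} {_ ∷ L'} (prep a p) f inv = begin
      ∑ (subsets (a ∷ L)) f                                         ≈⟨ ∑-subsets-∷ a L f ⟩
      ∑ (subsets L) f + ∑ (subsets L) (λ G → f (a ∷ G))
        ≈⟨ +-cong (∑-subsets-↭ p f inv) (∑-subsets-↭ p (λ G → f (a ∷ G)) (inv ∘′ prep a)) ⟩
      ∑ (subsets L') f + ∑ (subsets L') (λ G → f (a ∷ G))           ≈⟨ ∑-subsets-∷ a L' f ⟨
      ∑ (subsets (a ∷ L')) f                                        ∎
    ∑-subsets-↭ {a ∷ b ∷ L} {_ ∷ _ ∷ L'} (swap a b p) f inv = begin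
      ∑ (subsets (a ∷ b ∷ L)) f
        ≈⟨ ≈-trans (∑-subsets-∷ a (b ∷ L) f) (+-cong (∑-subsets-∷ b L f) (∑-subsets-∷ b L _)) ⟩
      (S f + S (λ G → f (b ∷ G))) + (S (λ G → f (a ∷ G)) + S (λ G → f (a ∷ b ∷ G)))
        ≈⟨ +-cong (+-cong (∑-subsets-↭ p f inv) (∑-subsets-↭ p (λ G → f (b ∷ G)) (inv ∘′ prep b)))
                  (+-cong (∑-subsets-↭ p (λ G → f (a ∷ G)) (inv ∘′ prep a))
                          (≈-trans (∑-subsets-↭ p (λ G → f (a ∷ b ∷ G)) (inv ∘′ prep a ∘′ prep b))
                                   (∑-cong (subsets L') (λ _ → inv (swap a b ↭.refl))))) ⟩
      (S' f + S' (λ G → f (b ∷ G))) + (S' (λ G → f (a ∷ G)) + S' (λ G → f (b ∷ a ∷ G))) ≈⟨ interchange _ _ _ _ ⟩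
      (S' f + S' (λ G → f (a ∷ G))) + (S' (λ G → f (b ∷ G)) + S' (λ G → f (b ∷ a ∷ G)))
        ≈⟨ ≈-trans (∑-subsets-∷ b (a ∷ L') f) (+-cong (∑-subsets-∷ a L' f) (∑-subsets-∷ a L' _)) ⟨
      ∑ (subsets (b ∷ a ∷ L')) f ∎
      where
      S S' : (List A → Carrier) → Carrier
      S  = ∑ (subsets L)
      S' = ∑ (subsets L')

    ∑-subsets-filterᵇ : ∀ (p : A → Bool) L f → (∀ G {a} → a ∈ G → p a ≡ false → f G ≈ 0#) →
      ∑ (subsets L) f ≈ ∑ (subsets (filterᵇ p L)) f
    ∑-subsets-filterᵇ p []      f vanish = ≈-refl
    ∑-subsets-filterᵇ p (a ∷ L) f vanish with p a in pa
    ... | true  = ≈-trans (∑-subsets-∷ a L f) (≈-trans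
        (+-cong (∑-subsets-filterᵇ p L f vanish)
                (∑-subsets-filterᵇ p L (λ G → f (a ∷ G)) (λ G a∈ → vanish (a ∷ G) (there a∈))))
        (≈-sym (∑-subsets-∷ a (filterᵇ p L) f)))
    ... | false = ≈-trans (∑-subsets-∷ a L f) (≈-trans
        (+-congˡ (∑-zero (subsets L) (λ {G} _ → vanish (a ∷ G) (here refl) pa)))
        (≈-trans (+-identityʳ _) (∑-subsets-filterᵇ p L f vanish)))

  module _ (x y z : Carrier) where

    term : Bool → ℕ → ℕ → ℕ → Carrier
    term b n i j = if b then pow x n * pow y i * pow z j else 0#

    weight : List ℕ → List Arc → Carrier
    weight Vs F = term (admissible Vs F) (length F) (kc Vs F) (kp Vs F)

    σπ≈∑weight : ∀ D → σπ D x y z ≈ ∑ (subsets (E D)) (weight (V D))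
    σπ≈∑weight D = ∑-filterᵇ (admissible (V D)) (subsets (E D)) _

    term-cong : ∀ {b b' n n' i i' j j'} → b ≡ b' → n ≡ n' → i ≡ i' → j ≡ j' → term b n i j ≡ term b' n' i' j'
    term-cong refl refl refl refl = refl

    term-x : ∀ b n i j → term b (suc n) i j ≈ x * term b n i j
    term-x true  n i j = ≈-trans (*-congʳ (*-assoc x _ _)) (*-assoc x _ _)
    term-x false n i j = ≈-sym (zeroʳ x)

    term-xy : ∀ b n i j → term b (suc n) (suc i) j ≈ x * y * term b n i j
    term-xy true  n i j = solve 5 (λ x y a b c → (x :* a) :* (y :* b) :* c := x :* y :* (a :* b :* c)) ≈-refl x y _ _ _
    term-xy false n i j = ≈-sym (zeroʳ (x * y))

    term-xz : ∀ b n i j → term b (suc n) i (suc j) ≈ x * z * term b n i j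
    term-xz true  n i j = solve 5 (λ x z a b c → (x :* a) :* b :* (z :* c) := x :* z :* (a :* b :* c)) ≈-refl x z _ _ _
    term-xz false n i j = ≈-sym (zeroʳ (x * z))

    z-split : ∀ w → x * z * w ≈ x * w + x * (z - 1#) * w
    z-split w = begin
      x * z * w                     ≈⟨ *-congʳ (*-congˡ z≈1+[z-1]) ⟩
      x * (1# + (z - 1#)) * w       ≈⟨ *-congʳ (distribˡ x 1# (z - 1#)) ⟩
      (x * 1# + x * (z - 1#)) * w   ≈⟨ distribʳ w _ _ ⟩
      x * 1# * w + x * (z - 1#) * w ≈⟨ +-congʳ (*-congʳ (*-identityʳ x)) ⟩
      x * w + x * (z - 1#) * w      ∎
      where
      z≈1+[z-1] : z ≈ 1# + (z - 1#)
      z≈1+[z-1] = ≈-sym (begin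
        1# + (z - 1#)   ≈⟨ +-comm 1# _ ⟩
        z - 1# + 1#     ≈⟨ +-assoc z (- 1#) 1# ⟩
        z + (- 1# + 1#) ≈⟨ +-congˡ (-‿inverseˡ 1#) ⟩
        z + 0#          ≈⟨ +-identityʳ z ⟩
        z               ∎)

    weight-↭ : ∀ Vs → ↭-Invariant (weight Vs)
    weight-↭ Vs p = reflexive (term-cong (admissible-↭ p Vs) (↭-length p)
      (components-↭ p isCycleᵇ-local Vs) (components-↭ p isPathᵇ-local Vs))

    weight-inadmissible : ∀ Vs F → admissible Vs F ≡ false → weight Vs F ≈ 0#
    weight-inadmissible Vs F inadm = reflexive (cong (λ b → term b (length F) (kc Vs F) (kp Vs F)) inadm)

    weight-isolated : ∀ {Vs G u} → Unique Vs → u ∈ Vs → EndsIn Vs G → AvoidsVertex u G →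
      weight Vs G ≡ weight (Vs ∖ u) G
    weight-isolated {G = G} uniq u∈Vs ends avoids = term-cong {n = length G} admissible-≡ refl kc-≡ kp-≡
      where open IsolatedVertex uniq u∈Vs ends avoids

    weight-loop : ∀ {Vs G u} → Unique Vs → u ∈ Vs → EndsIn Vs G → AvoidsVertex u G →
      weight Vs ((u , u) ∷ G) ≈ x * y * weight (Vs ∖ u) G
    weight-loop {Vs} {G} {u} uniq u∈Vs ends avoids =
      ≈-trans (reflexive (term-cong {n = suc (length G)} admissible-≡ refl kc-≡ kp-≡))
              (term-xy (admissible (Vs ∖ u) G) (length G) (kc (Vs ∖ u) G) (kp (Vs ∖ u) G))
      where open Loop uniq u∈Vs ends avoids

    module ArcWeight {Vs G u v} (uniq : Unique Vs) (u∈Vs : u ∈ Vs) (v∈Vs : v ∈ Vs) (u≢v : u ≢ v)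
                     (ends : EndsIn Vs G) (free : TailHeadFree u v G) where

      open Contraction uniq u∈Vs v∈Vs u≢v ends free

      private
        contracted : T (admissible Vs F) →
          weight Vs F ≡ term (admissible V' G') (suc (length G')) (kc V' G') (𝟙 isolatedArc ℕ.+ kp V' G')
        contracted adm = term-cong admissible-≡ (cong suc (sym (length-map ρ-arc G))) kc-≡ (kp-≡ adm)

      weight-arc : weight Vs F ≈ (if isolatedArc then x * z * weight V' G' else x * weight V' G')
      weight-arc = by-admissibility (admissible Vs F) refl
        where
        shift : ∀ b → term (admissible V' G') (suc (length G')) (kc V' G') (𝟙 b ℕ.+ kp V' G')
                      ≈ (if b then x * z * weight V' G' else x * weight V' G')
        shift true  = term-xz (admissible V' G') (length G') (kc V' G') (kp V' G')
        shift false = term-x (admissible V' G') (length G') (kc V' G') (kp V' G')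
        vanish : admissible V' G' ≡ false → ∀ b → (if b then x * z * weight V' G' else x * weight V' G') ≈ 0#
        vanish inadm true  = ≈-trans (*-congˡ (weight-inadmissible V' G' inadm)) (zeroʳ _)
        vanish inadm false = ≈-trans (*-congˡ (weight-inadmissible V' G' inadm)) (zeroʳ _)
        by-admissibility : ∀ b → admissible Vs F ≡ b →
          weight Vs F ≈ (if isolatedArc then x * z * weight V' G' else x * weight V' G')
        by-admissibility true  adm = ≈-trans (reflexive (contracted (subst T (sym adm) tt))) (shift isolatedArc)
        by-admissibility false adm =
          ≈-trans (weight-inadmissible Vs F adm) (≈-sym (vanish (trans (sym admissible-≡) adm) isolatedArc))

      weight-dagger : (if isolatedArc then weight V' G' else 0#)
                    ≈ (if all (λ a → freeᵇ v v a ∧ freeᵇ u u a) G then weight ((Vs ∖ u) ∖ v) G else 0#)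
      weight-dagger rewrite sym isolatedArc-≡ with isolatedArc in bare
      ... | false = ≈-refl
      ... | true  = begin
        weight V' G'             ≡⟨ cong (weight V') (G'≡G avoids-v) ⟩
        weight V' G              ≡⟨ weight-isolated (Unique-∖ {v} uniq) u∈V' (∖-ends Vs ends avoids-v) avoids-u ⟩
        weight (V' ∖ u) G        ≡⟨ cong (λ L → weight L G) (∖-comm Vs u v) ⟩
        weight ((Vs ∖ u) ∖ v) G  ∎
        where
        avoids-u = proj₁ (isolatedArc-avoids (subst T (sym bare) tt))
        avoids-v = proj₂ (isolatedArc-avoids (subst T (sym bare) tt))

      weight-arc-split : weight Vs F ≈ x * weight V' G' + x * (z - 1#) * (if isolatedArc then weight V' G' else 0#)
      weight-arc-split = ≈-trans weight-arc (split isolatedArc)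
        where
        w = weight V' G'
        split : ∀ b → (if b then x * z * w else x * w) ≈ x * w + x * (z - 1#) * (if b then w else 0#)
        split true  = z-split w
        split false = ≈-sym (≈-trans (+-congˡ (zeroʳ _)) (+-identityʳ _))

    module _ (D : Digraph) (wf : WF D) (i : Fin (length (E D))) {u v} (e≡ : lookup (E D) i ≡ (u , v)) where

      private
        Rm = removeAt (E D) i

        e∈ : (u , v) ∈ E D
        e∈ = subst (_∈ E D) e≡ (∈-lookup i)

      u∈V : u ∈ V D
      u∈V = proj₁ (All.lookup (proj₂ wf) e∈)

      v∈V : v ∈ V D
      v∈V = proj₂ (All.lookup (proj₂ wf) e∈)

      sublist-ends : ∀ {G} → G ∈ subsets (filterᵇ (freeᵇ u v) Rm) → EndsIn (V D) G
      sublist-ends G∈ = All.tabulate λ a∈ →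
        All.lookup (proj₂ wf) (removeAt-⊆ (E D) i (proj₁ (∈-filter⁻ (λ a → T? (freeᵇ u v a)) (subsets-⊆ _ G∈ a∈))))

      σπ-split : σπ D x y z ≈
        σπ (deleteArc D i) x y z + ∑ (subsets (filterᵇ (freeᵇ u v) Rm)) (λ G → weight (V D) ((u , v) ∷ G))
      σπ-split = begin
        σπ D x y z                                                          ≈⟨ σπ≈∑weight D ⟩
        ∑ (subsets (E D)) (weight (V D))
          ≈⟨ ∑-subsets-↭ (subst (λ a → E D ↭ a ∷ Rm) e≡ (↭-lookup (E D) i)) (weight (V D)) (weight-↭ (V D)) ⟩
        ∑ (subsets ((u , v) ∷ Rm)) (weight (V D))                          ≈⟨ ∑-subsets-∷ (u , v) Rm (weight (V D)) ⟩
        ∑ (subsets Rm) (weight (V D)) + ∑ (subsets Rm) (λ G → weight (V D) ((u , v) ∷ G))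
          ≈⟨ +-cong (≈-sym (σπ≈∑weight (deleteArc D i))) (∑-subsets-filterᵇ (freeᵇ u v) Rm _ vanish) ⟩
        σπ (deleteArc D i) x y z + ∑ (subsets (filterᵇ (freeᵇ u v) Rm)) (λ G → weight (V D) ((u , v) ∷ G)) ∎
        where
        vanish : ∀ G {a} → a ∈ G → freeᵇ u v a ≡ false → weight (V D) ((u , v) ∷ G) ≈ 0#
        vanish G a∈ not-free = weight-inadmissible (V D) _ (inadmissible-∷ (V D) u∈V v∈V a∈ not-free)

    σπ-loop : ∀ D → WF D → ∀ i {u} → lookup (E D) i ≡ (u , u) →
      σπ D x y z ≈ σπ (deleteArc D i) x y z + x * y * σπ (contractArc D i) x y z
    σπ-loop D wf i {u} e≡ = ≈-trans (σπ-split D wf i e≡) (+-congˡ (begin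
      ∑ (subsets K) (λ G → weight (V D) ((u , u) ∷ G))
        ≈⟨ ∑-cong (subsets K) (λ G∈ → weight-loop (proj₁ wf) (u∈V D wf i e≡) (sublist-ends D wf i e≡ G∈)
                                                  (sublist-free (removeAt (E D) i) G∈)) ⟩
      ∑ (subsets K) (λ G → x * y * weight (V D ∖ u) G)       ≈⟨ ∑-*ˡ (subsets K) (x * y) _ ⟩
      x * y * ∑ (subsets K) (weight (V D ∖ u))
        ≡⟨ cong (λ L → x * y * ∑ (subsets L) (weight (V D ∖ u))) (filterᵇ-removeAt (freeᵇ u u) (E D) i e-not-free) ⟩
      x * y * ∑ (subsets (filterᵇ (freeᵇ u u) (E D))) (weight (V D ∖ u))
        ≈⟨ *-congˡ (≈-sym (σπ≈∑weight (deleteVertex u D))) ⟩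
      x * y * σπ (deleteVertex u D) x y z
        ≡⟨ cong (λ D' → x * y * σπ D' x y z) (sym (contractArc-loop D i e≡)) ⟩
      x * y * σπ (contractArc D i) x y z                     ∎))
      where
      K = filterᵇ (freeᵇ u u) (removeAt (E D) i)
      e-not-free : freeᵇ u u (lookup (E D) i) ≡ false
      e-not-free rewrite e≡ | ≡ᵇ-refl u = refl

    σπ-arc : ∀ D → WF D → ∀ i {u v} → lookup (E D) i ≡ (u , v) → u ≢ v →
      σπ D x y z ≈ σπ (deleteArc D i) x y z + x * σπ (contractArc D i) x y z + x * (z - 1#) * σπ (daggerArc D i) x y z
    σπ-arc D wf i {u} {v} e≡ u≢v = ≈-trans (σπ-split D wf i e≡) (≈-trans (+-congˡ (begin
      ∑ (subsets K) (λ G → weight (V D) ((u , v) ∷ G))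
        ≈⟨ ∑-cong (subsets K) pointwise ⟩
      ∑ (subsets K) (λ G → x * contracted G + x * (z - 1#) * daggered G)
        ≈⟨ ≈-trans (∑-+ (subsets K) _ _)
                   (+-cong (∑-*ˡ (subsets K) x contracted) (∑-*ˡ (subsets K) (x * (z - 1#)) daggered)) ⟩
      x * ∑ (subsets K) contracted + x * (z - 1#) * ∑ (subsets K) daggered
        ≈⟨ +-cong (*-congˡ contracted-sum) (*-congˡ daggered-sum) ⟩
      x * σπ (contractArc D i) x y z + x * (z - 1#) * σπ (daggerArc D i) x y z ∎)) (≈-sym (+-assoc _ _ _)))
      where
      Rm = removeAt (E D) i
      K = filterᵇ (freeᵇ u v) Rm
      ρ-arc : Arc → Arc
      ρ-arc a = rename v u (proj₁ a) , rename v u (proj₂ a)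
      bothᵇ : Arc → Bool
      bothᵇ a = freeᵇ v v a ∧ freeᵇ u u a
      contracted : List Arc → Carrier
      contracted G = weight (V D ∖ v) (map ρ-arc G)
      daggered : List Arc → Carrier
      daggered G = if all bothᵇ G then weight ((V D ∖ u) ∖ v) G else 0#

      pointwise : ∀ {G} → G ∈ subsets K → weight (V D) ((u , v) ∷ G) ≈ x * contracted G + x * (z - 1#) * daggered G
      pointwise G∈ = ≈-trans weight-arc-split (+-congˡ (*-congˡ weight-dagger))
        where
        open ArcWeight (proj₁ wf) (u∈V D wf i e≡) (v∈V D wf i e≡) u≢v (sublist-ends D wf i e≡ G∈) (sublist-free Rm G∈)

      contracted-sum : ∑ (subsets K) contracted ≈ σπ (contractArc D i) x y z
      contracted-sum = begin
        ∑ (subsets K) contracted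
          ≡⟨ sym (∑-map (map ρ-arc) (subsets K) (weight (V D ∖ v))) ⟩
        ∑ (map (map ρ-arc) (subsets K)) (weight (V D ∖ v))
          ≡⟨ cong (λ L → ∑ L (weight (V D ∖ v))) (sym (subsets-map ρ-arc K)) ⟩
        ∑ (subsets (map ρ-arc K)) (weight (V D ∖ v))
          ≡⟨ cong (λ L → ∑ (subsets (map ρ-arc L)) (weight (V D ∖ v))) (filterᵇ-removeAt (freeᵇ u v) (E D) i e-not-free) ⟩
        ∑ (subsets (map ρ-arc (filterᵇ (freeᵇ u v) (E D)))) (weight (V D ∖ v))
          ≈⟨ ≈-sym (σπ≈∑weight (mkDigraph (V D ∖ v) (map ρ-arc (filterᵇ (freeᵇ u v) (E D))))) ⟩
        σπ (mkDigraph (V D ∖ v) (map ρ-arc (filterᵇ (freeᵇ u v) (E D)))) x y z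
          ≡⟨ cong (λ D' → σπ D' x y z) (sym (contractArc-non-loop D i e≡ u≢v)) ⟩
        σπ (contractArc D i) x y z                                   ∎
        where
        e-not-free : freeᵇ u v (lookup (E D) i) ≡ false
        e-not-free rewrite e≡ | ≡ᵇ-refl u = refl

      daggered-sum : ∑ (subsets K) daggered ≈ σπ (daggerArc D i) x y z
      daggered-sum = begin
        ∑ (subsets K) daggered                                       ≈⟨ ∑-subsets-filterᵇ bothᵇ K daggered vanish ⟩
        ∑ (subsets (filterᵇ bothᵇ K)) daggered
          ≈⟨ ∑-cong (subsets (filterᵇ bothᵇ K)) (λ {G} G∈ →
               reflexive (cong (λ b → if b then weight ((V D ∖ u) ∖ v) G else 0#) (all-sublist-filterᵇ bothᵇ K G∈))) ⟩
        ∑ (subsets (filterᵇ bothᵇ K)) (weight ((V D ∖ u) ∖ v))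
          ≡⟨ cong (λ L → ∑ (subsets L) (weight ((V D ∖ u) ∖ v))) (filterᵇ-avoids u v Rm) ⟩
        ∑ (subsets (filterᵇ (freeᵇ v v) (filterᵇ (freeᵇ u u) Rm))) (weight ((V D ∖ u) ∖ v))
          ≡⟨ cong (λ L → ∑ (subsets (filterᵇ (freeᵇ v v) L)) (weight ((V D ∖ u) ∖ v)))
                  (filterᵇ-removeAt (freeᵇ u u) (E D) i e-not-free) ⟩
        ∑ (subsets (filterᵇ (freeᵇ v v) (filterᵇ (freeᵇ u u) (E D)))) (weight ((V D ∖ u) ∖ v))
          ≈⟨ ≈-sym (σπ≈∑weight (deleteVertex v (deleteVertex u D))) ⟩
        σπ (deleteVertex v (deleteVertex u D)) x y z
          ≡⟨ cong (λ D' → σπ D' x y z) (sym (daggerArc-≡ D i e≡)) ⟩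
        σπ (daggerArc D i) x y z                                     ∎
        where
        vanish : ∀ G {a} → a ∈ G → bothᵇ a ≡ false → daggered G ≈ 0#
        vanish G a∈ not-both =
          reflexive (cong (λ b → if b then weight ((V D ∖ u) ∖ v) G else 0#) (all-false bothᵇ a∈ not-both))
        e-not-free : freeᵇ u u (lookup (E D) i) ≡ false
        e-not-free rewrite e≡ | ≡ᵇ-refl u = refl

    σπ-arcless : ∀ n → σπ (arcless n) x y z ≈ 1#
    σπ-arcless n = begin
      σπ (arcless n) x y z    ≈⟨ ≈-trans (σπ≈∑weight (arcless n)) (+-identityʳ _) ⟩
      weight (upTo n) []      ≡⟨ term-cong {n = 0} (admissible-[] (upTo n)) refl (kc-[] (upTo n)) (kp-[] (upTo n)) ⟩
      1# * 1# * 1#            ≈⟨ ≈-trans (*-identityʳ _) (*-identityʳ _) ⟩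
      1#                      ∎

theorem3p2 : ∀ {c ℓ : Level} (R : CommutativeRing c ℓ) →
    let open CommutativeRing R
        open CyclePath R
    in (∀ (x y z : Carrier) (D : Digraph) → WF D → (e : Fin (length (E D))) →
          (proj₁ (lookup (E D) e) ≡ proj₂ (lookup (E D) e) →
            σπ D x y z ≈ σπ (deleteArc D e) x y z + x * y * σπ (contractArc D e) x y z)
          × (proj₁ (lookup (E D) e) ≢ proj₂ (lookup (E D) e) →
            σπ D x y z ≈ σπ (deleteArc D e) x y z + x * σπ (contractArc D e) x y z
                          + x * (z - 1#) * σπ (daggerArc D e) x y z))
       × (∀ (x y z : Carrier) (n : ℕ) → σπ (arcless n) x y z ≈ 1#)
theorem3p2 R =
    (λ x y z D wf e →
        (λ loop → σπ-loop x y z D wf e (cong (proj₁ (lookup (E D) e) ,_) (sym loop)))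
      , (λ non-loop → σπ-arc x y z D wf e refl non-loop))
  , σπ-arcless
  where open Expansion R
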